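{- If $n\equiv 1$ or $3 \pmod 6$ and $V$ is a set of $n$ points in general position in the plane, then \[\frac{n^2}{6}-\frac{n}{6}=\frac13\binom{n}{2}\le \alpha(D_V(n)).\]
   Context: A set of points in the plane is in general position if no three are collinear. For such a set $V$ of $n$ points, the segment disjointness graph $D_V(n)$ has as vertices all $\binom{n}{2}$ closed straight-line segments with both endpoints in $V$, two segments being adjacent iff they are disjoint (no common point, including endpoints). An $l$-coloring of a graph $G$ is a surjective map $V(G)\to[l]$; it is proper if adjacent vertices get different colors and complete if for every two distinct colors $i,j$ there is an edge with endpoints colored $i$ and $j$. The achromatic number $\alpha(G)$ is the largest $l$ admitting a proper complete $l$-coloring. -}

module Defs where

open import Level using (Level; _⊔_; suc)
open import Algebra.Bundles using (CommutativeRing)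
open import Relation.Binary.Structures using (IsStrictTotalOrder)
open import Relation.Nullary using (¬_)
open import Relation.Binary.PropositionalEquality using (_≡_; _≢_)
open import Data.Product using (Σ; ∃; ∃-syntax; _×_; _,_; proj₁; proj₂)
open import Data.Sum using (_⊎_)
open import Data.Fin using (Fin) renaming (_<_ to _<ᶠ_)
open import Function.Definitions using (Surjective)
open import Data.Nat using (ℕ) renaming (_≤_ to _≤ℕ_)

-- An ordered field: a commutative ring with multiplicative inverses of
-- nonzero elements and a strict total order compatible with + and *.
-- (The real plane ℝ² is the instance the paper has in mind.)
record OrderedField (c ℓ : Level) : Set (suc (c ⊔ ℓ)) where
  field
    commutativeRing : CommutativeRing c ℓ
  open CommutativeRing commutativeRing public
  field
    _<_                : Carrier → Carrier → Set ℓ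
    isStrictTotalOrder : IsStrictTotalOrder _≈_ _<_
    +-mono-<           : ∀ {x y} z → x < y → (x + z) < (y + z)
    *-pos              : ∀ {x y} → 0# < x → 0# < y → 0# < (x * y)
    0<1                : 0# < 1#
    inverse            : ∀ x → ¬ (x ≈ 0#) → ∃[ y ] (x * y ≈ 1#)

  _≤_ : Carrier → Carrier → Set ℓ
  x ≤ y = x < y ⊎ x ≈ y

-- Vertices of D_V(n): 2-element subsets {i, j} of the index set Fin n,
-- represented as ordered pairs with i < j.
Segment : ℕ → Set
Segment n = Σ (Fin n × Fin n) (λ ij → proj₁ ij <ᶠ proj₂ ij)

module Plane {c ℓ : Level} (F : OrderedField c ℓ) where
  open OrderedField F

  Point : Set c
  Point = Carrier × Carrier

  _≈ₚ_ : Point → Point → Set ℓ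
  (x₁ , y₁) ≈ₚ (x₂ , y₂) = (x₁ ≈ x₂) × (y₁ ≈ y₂)

  Collinear : Point → Point → Point → Set ℓ
  Collinear (px , py) (qx , qy) (rx , ry) =
    ((qx - px) * (ry - py)) - ((qy - py) * (rx - px)) ≈ 0#

  OnSegment : Point → Point → Point → Set (c ⊔ ℓ)
  OnSegment p (ax , ay) (bx , by) =
    ∃[ t ] ((0# ≤ t) × (t ≤ 1#) ×
            (p ≈ₚ ((ax + (t * (bx - ax))) , (ay + (t * (by - ay))))))

  Distinct : ∀ {n} → (Fin n → Point) → Set ℓ
  Distinct V = ∀ i j → i ≢ j → ¬ (V i ≈ₚ V j)

  GeneralPosition : ∀ {n} → (Fin n → Point) → Set ℓ
  GeneralPosition V = ∀ i j k → i ≢ j → j ≢ k → i ≢ k →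
                      ¬ Collinear (V i) (V j) (V k)

  -- Adjacency in D_V(n): the closed segments V i V j and V k V l are
  -- disjoint (have no common point, endpoints included).
  SegDisjoint : ∀ {n} → (Fin n → Point) → Segment n → Segment n → Set (c ⊔ ℓ)
  SegDisjoint V ((i , j) , _) ((k , l) , _) =
    ¬ (∃[ p ] (OnSegment p (V i) (V j) × OnSegment p (V k) (V l)))

  ProperCompleteColoring : ∀ {n} → (Fin n → Point) → (m : ℕ) →
                           (Segment n → Fin m) → Set (c ⊔ ℓ)
  ProperCompleteColoring V m col =
    Surjective _≡_ _≡_ col ×
    (∀ s t → SegDisjoint V s t → col s ≢ col t) ×
    (∀ a b → a ≢ b → ∃[ s ] ∃[ t ] (SegDisjoint V s t × col s ≡ a × col t ≡ b))

  -- k ≤ α(D_V(n)): some proper complete m-coloring with k ≤ m exists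
  -- (α is the largest such m; it is finite since m ≤ (n choose 2)).
  _≤α[_] : ∀ {n} → ℕ → (Fin n → Point) → Set (c ⊔ ℓ)
  k ≤α[ V ] = ∃[ m ] (k ≤ℕ m × ∃[ col ] ProperCompleteColoring V m col)

module Submission where

-- For such n there is a Steiner triple system on the n indices: every pair
-- {a, b} lies in exactly one triple {a, b, third a b}.  Colour each segment
-- by its triple; there are (n choose 2)/3 colours.  The colouring is proper,
-- since two segments of one triple share an endpoint; it is complete, since
-- two distinct triples share at most one point, so an edge ab of the first
-- avoids the second, and by general position two vertices of the second lie
-- strictly on the same side of the line ab, giving a segment disjoint from ab.

open import Defs
open import Level using (Level)
open import Algebra.Bundles using (CommutativeRing)
open import Data.Nat using (ℕ; NonZero; zero; suc; _%_; _/_)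
import Data.Nat.Properties as ℕP
open import Data.Nat.Combinatorics using (_C_)
open import Data.Fin as Fin using (Fin; zero; suc; toℕ)
import Data.Fin.Properties as FinP
open import Data.Fin.Patterns using (0F; 1F; 2F)
open import Data.Product using (Σ; ∃-syntax; _×_; _,_; proj₁; proj₂)
open import Data.Sum using (_⊎_; inj₁; inj₂)
open import Data.Empty using (⊥; ⊥-elim)
open import Relation.Nullary using (¬_; Dec; yes; no)
open import Relation.Binary.PropositionalEquality using (_≡_; _≢_; ≢-sym)
open import Relation.Binary.Definitions using (DecidableEquality)
open import Function.Bundles using (_↔_)

-- The integers map homomorphically into every commutative ring.  This makes
-- the standard ring solver, which needs such a coefficient morphism,
-- available for arbitrary commutative rings (here: the ordered field).
module IntegerSolver {c ℓ : Level} (R : CommutativeRing c ℓ) where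
  import Data.Nat as ℕ
  open import Data.Integer as ℤ using (ℤ; +_; -[1+_]; _⊖_)
  import Relation.Binary.PropositionalEquality as ≡
  import Data.Integer.Properties as ℤP
  open import Data.Sign as Sign using (Sign)
  open import Data.Maybe using (Maybe; just; nothing)
  import Algebra.Solver.Ring.AlmostCommutativeRing as ACR
  open CommutativeRing R
  open import Algebra.Properties.Ring ring
  open import Algebra.Properties.Semiring.Mult semiring renaming (_×_ to _·_)
  open import Relation.Binary.Reasoning.Setoid setoid

  ⟦_⟧ : ℤ → Carrier
  ⟦ + n ⟧ = n · 1#
  ⟦ -[1+ n ] ⟧ = - (suc n · 1#)

  ⊖-homo : ∀ m n → ⟦ m ⊖ n ⟧ ≈ m · 1# + - (n · 1#)
  ⊖-homo zero zero = sym (trans (+-congˡ -0#≈0#) (+-identityʳ 0#))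
  ⊖-homo (suc m) zero = sym (trans (+-congˡ -0#≈0#) (+-identityʳ _))
  ⊖-homo zero (suc n) = sym (+-identityˡ _)
  ⊖-homo (suc m) (suc n) = begin
    ⟦ suc m ⊖ suc n ⟧              ≡⟨ ≡.cong ⟦_⟧ (ℤP.[1+m]⊖[1+n]≡m⊖n m n) ⟩
    ⟦ m ⊖ n ⟧                      ≈⟨ ⊖-homo m n ⟩
    m · 1# + - (n · 1#)            ≈⟨ +-congʳ (sym (+-identityˡ _)) ⟩
    (0# + m · 1#) + - (n · 1#)     ≈⟨ +-congʳ (+-congʳ (sym (-‿inverseʳ 1#))) ⟩
    ((1# + - 1#) + m · 1#) + - (n · 1#)  ≈⟨ +-congʳ (+-assoc _ _ _) ⟩
    (1# + (- 1# + m · 1#)) + - (n · 1#)  ≈⟨ +-congʳ (+-congˡ (+-comm _ _)) ⟩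
    (1# + (m · 1# + - 1#)) + - (n · 1#)  ≈⟨ +-congʳ (sym (+-assoc _ _ _)) ⟩
    ((1# + m · 1#) + - 1#) + - (n · 1#)  ≈⟨ +-assoc _ _ _ ⟩
    (1# + m · 1#) + (- 1# + - (n · 1#))  ≈⟨ +-congˡ (-‿+-comm _ _) ⟩
    (1# + m · 1#) + - (1# + n · 1#) ∎

  +-homo : ∀ i j → ⟦ i ℤ.+ j ⟧ ≈ ⟦ i ⟧ + ⟦ j ⟧
  +-homo -[1+ m ] -[1+ n ] = begin
    - (suc (suc (m ℕ.+ n)) · 1#)     ≡⟨ ≡.cong (λ k → - (k · 1#)) (≡.sym (ℕP.+-suc (suc m) n)) ⟩
    - ((suc m ℕ.+ suc n) · 1#)       ≈⟨ -‿cong (×-homo-+ 1# (suc m) (suc n)) ⟩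
    - (suc m · 1# + suc n · 1#)      ≈⟨ sym (-‿+-comm _ _) ⟩
    - (suc m · 1#) + - (suc n · 1#) ∎
  +-homo -[1+ m ] (+ n) = trans (⊖-homo n (suc m)) (+-comm _ _)
  +-homo (+ m) -[1+ n ] = ⊖-homo m (suc n)
  +-homo (+ m) (+ n) = ×-homo-+ 1# m n

  signed : Sign → Carrier → Carrier
  signed Sign.+ x = x
  signed Sign.- x = - x

  signed-cong : ∀ s {x y} → x ≈ y → signed s x ≈ signed s y
  signed-cong Sign.+ p = p
  signed-cong Sign.- p = -‿cong p

  signed-* : ∀ s t x y → signed (s Sign.* t) (x * y) ≈ signed s x * signed t y
  signed-* Sign.- Sign.- x y = trans (sym (-‿involutive _))
    (trans (-‿cong (-‿distribˡ-* x y)) (-‿distribʳ-* (- x) y))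
  signed-* Sign.- Sign.+ x y = -‿distribˡ-* x y
  signed-* Sign.+ Sign.- x y = -‿distribʳ-* x y
  signed-* Sign.+ Sign.+ x y = refl

  ◃-homo : ∀ s n → ⟦ s ℤ.◃ n ⟧ ≈ signed s (n · 1#)
  ◃-homo Sign.- zero = sym -0#≈0#
  ◃-homo Sign.+ zero = refl
  ◃-homo Sign.- (suc n) = refl
  ◃-homo Sign.+ (suc n) = refl

  sign-abs-homo : ∀ i → ⟦ i ⟧ ≈ signed (ℤ.sign i) (ℤ.∣ i ∣ · 1#)
  sign-abs-homo (+ n) = refl
  sign-abs-homo -[1+ n ] = refl

  *-homo : ∀ i j → ⟦ i ℤ.* j ⟧ ≈ ⟦ i ⟧ * ⟦ j ⟧
  *-homo i j = begin
    ⟦ i ℤ.* j ⟧                          ≈⟨ ◃-homo s (ℤ.∣ i ∣ ℕ.* ℤ.∣ j ∣) ⟩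
    signed s ((ℤ.∣ i ∣ ℕ.* ℤ.∣ j ∣) · 1#) ≈⟨ signed-cong s (×1-homo-* ℤ.∣ i ∣ ℤ.∣ j ∣) ⟩
    signed s ((ℤ.∣ i ∣ · 1#) * (ℤ.∣ j ∣ · 1#))
      ≈⟨ signed-* (ℤ.sign i) (ℤ.sign j) (ℤ.∣ i ∣ · 1#) (ℤ.∣ j ∣ · 1#) ⟩
    signed (ℤ.sign i) (ℤ.∣ i ∣ · 1#) * signed (ℤ.sign j) (ℤ.∣ j ∣ · 1#)
      ≈⟨ sym (*-cong (sign-abs-homo i) (sign-abs-homo j)) ⟩
    ⟦ i ⟧ * ⟦ j ⟧ ∎
    where s = ℤ.sign i Sign.* ℤ.sign j

  neg-homo : ∀ i → ⟦ ℤ.- i ⟧ ≈ - ⟦ i ⟧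
  neg-homo (+ zero) = sym -0#≈0#
  neg-homo (+ suc n) = refl
  neg-homo -[1+ n ] = sym (-‿involutive _)

  ℤ-morphism : ℤ.+-*-rawRing ACR.-Raw-AlmostCommutative⟶ ACR.fromCommutativeRing R
  ℤ-morphism = record
    { ⟦_⟧ = ⟦_⟧ ; +-homo = +-homo ; *-homo = *-homo ; -‿homo = neg-homo
    ; 0-homo = refl ; 1-homo = +-identityʳ 1# }

  coefficient-equality : ∀ i j → Maybe (⟦ i ⟧ ≈ ⟦ j ⟧)
  coefficient-equality i j with i ℤ.≟ j
  ... | yes ≡.refl = just refl
  ... | no _ = nothing

  open import Algebra.Solver.Ring ℤ.+-*-rawRing (ACR.fromCommutativeRing R)
    ℤ-morphism coefficient-equality public
    using (solve; _:+_; _:*_; :-_; _:-_; _:=_; con)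

-- The orientation
-- determinant orient A B P is zero on the line AB and affine along any
-- segment KL; hence if K and L lie strictly on the same side of the line AB,
-- the segments AB and KL are disjoint.
module Orientation {c ℓ : Level} (F : OrderedField c ℓ) where
  open import Relation.Binary.Structures using (IsStrictTotalOrder)
  open import Relation.Binary.Definitions using (tri<; tri≈; tri>)
  open import Data.Integer using (+_)
  open OrderedField F
  open Plane F
  open IntegerSolver commutativeRing
  open import Algebra.Properties.Ring ring using (-0#≈0#)
  module STO = IsStrictTotalOrder isStrictTotalOrder

  -- twice the signed area of the triangle PQR; Collinear P Q R unfolds to
  -- orient P Q R ≈ 0#
  orient : Point → Point → Point → Carrier
  orient (px , py) (qx , qy) (rx , ry) =
    ((qx - px) * (ry - py)) - ((qy - py) * (rx - px))

  orient-congʳ : ∀ A B {P Q} → P ≈ₚ Q → orient A B P ≈ orient A B Q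
  orient-congʳ (px , py) (qx , qy) (e₁ , e₂) =
    +-cong (*-cong refl (+-cong e₂ refl)) (-‿cong (*-cong refl (+-cong e₁ refl)))

  orient-on-line : ∀ a₁ a₂ b₁ b₂ t →
    orient (a₁ , a₂) (b₁ , b₂) (a₁ + t * (b₁ - a₁) , a₂ + t * (b₂ - a₂)) ≈ 0#
  orient-on-line = solve 5 (λ a₁ a₂ b₁ b₂ t →
    ((b₁ :- a₁) :* ((a₂ :+ t :* (b₂ :- a₂)) :- a₂))
      :- ((b₂ :- a₂) :* ((a₁ :+ t :* (b₁ :- a₁)) :- a₁)) := con (+ 0)) refl

  orient-affine : ∀ a₁ a₂ b₁ b₂ k₁ k₂ l₁ l₂ s →
    let A = (a₁ , a₂) ; B = (b₁ , b₂) in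
    orient A B (k₁ + s * (l₁ - k₁) , k₂ + s * (l₂ - k₂)) ≈
    orient A B (k₁ , k₂) + s * (orient A B (l₁ , l₂) - orient A B (k₁ , k₂))
  orient-affine = solve 9 (λ a₁ a₂ b₁ b₂ k₁ k₂ l₁ l₂ s →
    let o : _ → _ → _
        o x y = ((b₁ :- a₁) :* (y :- a₂)) :- ((b₂ :- a₂) :* (x :- a₁)) in
    o (k₁ :+ s :* (l₁ :- k₁)) (k₂ :+ s :* (l₂ :- k₂))
      := o k₁ k₂ :+ s :* (o l₁ l₂ :- o k₁ k₂)) refl

  -- it is the convex combination (1 − s) α + s β  (the solver writes the
  -- integer constant 1 as 1# + 0#)
  interpolate-as-combination : ∀ α β s → α + s * (β - α) ≈ ((1# + 0#) - s) * α + s * β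
  interpolate-as-combination = solve 3 (λ α β s →
    α :+ s :* (β :- α) := (con (+ 1) :- s) :* α :+ s :* β) refl

  negate-interpolation : ∀ α β s → - (α + s * (β - α)) ≈ (- α) + s * ((- β) - (- α))
  negate-interpolation = solve 3 (λ α β s →
    :- (α :+ s :* (β :- α)) := (:- α) :+ s :* ((:- β) :- (:- α))) refl

  interpolate-end : ∀ α β → α + (1# + 0#) * (β - α) ≈ β
  interpolate-end = solve 2 (λ α β → α :+ con (+ 1) :* (β :- α) := β) refl

  <-irrefl : ∀ {x} → ¬ (x < x)
  <-irrefl = STO.irrefl refl

  0<y-x : ∀ {x y} → x < y → 0# < (y - x)
  0<y-x {x} x<y = STO.<-respˡ-≈ (-‿inverseʳ x) (+-mono-< (- x) x<y)

  0<-x : ∀ {x} → x < 0# → 0# < (- x)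
  0<-x {x} x<0 =
    STO.<-respʳ-≈ (+-identityˡ (- x)) (STO.<-respˡ-≈ (-‿inverseʳ x) (+-mono-< (- x) x<0))

  pos+nonneg : ∀ {x y} → 0# < x → 0# ≤ y → 0# < (x + y)
  pos+nonneg {x} 0<x (inj₂ 0≈y) =
    STO.<-respʳ-≈ (trans (sym (+-identityʳ x)) (+-congˡ 0≈y)) 0<x
  pos+nonneg {x} {y} 0<x (inj₁ 0<y) = STO.trans 0<x
    (STO.<-respˡ-≈ (+-identityˡ x) (STO.<-respʳ-≈ (+-comm y x) (+-mono-< x 0<y)))

  nonneg*pos : ∀ {x y} → 0# ≤ x → 0# < y → 0# ≤ (x * y)
  nonneg*pos (inj₁ 0<x) 0<y = inj₁ (*-pos 0<x 0<y)
  nonneg*pos {x} {y} (inj₂ 0≈x) 0<y = inj₂ (trans (sym (zeroˡ y)) (*-congʳ 0≈x))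

  between-positives-nonzero : ∀ α β s → 0# < α → 0# < β → 0# ≤ s → s ≤ 1# →
                    ¬ (α + s * (β - α) ≈ 0#)
  between-positives-nonzero α β s 0<α 0<β 0≤s (inj₂ s≈1) eq = <-irrefl
    (STO.<-respʳ-≈ (trans (sym (trans (+-congˡ (*-congʳ (trans s≈1
      (sym (+-identityʳ 1#))))) (interpolate-end α β))) eq) 0<β)
  between-positives-nonzero α β s 0<α 0<β 0≤s (inj₁ s<1) eq = <-irrefl
    (STO.<-respʳ-≈ (trans (sym (interpolate-as-combination α β s)) eq) combination-pos)
    where
    0<1-s : 0# < ((1# + 0#) - s)
    0<1-s = STO.<-respʳ-≈ (+-congʳ (sym (+-identityʳ 1#))) (0<y-x s<1)
    combination-pos : 0# < (((1# + 0#) - s) * α + s * β)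
    combination-pos = pos+nonneg (*-pos 0<1-s 0<α) (nonneg*pos 0≤s 0<β)

  between-negatives-nonzero : ∀ α β s → α < 0# → β < 0# → 0# ≤ s → s ≤ 1# →
                            ¬ (α + s * (β - α) ≈ 0#)
  between-negatives-nonzero α β s α<0 β<0 0≤s s≤1 eq =
    between-positives-nonzero (- α) (- β) s (0<-x α<0) (0<-x β<0) 0≤s s≤1
      (trans (sym (negate-interpolation α β s)) (trans (-‿cong eq) -0#≈0#))

  data Side : Set where
    left right : Side

  OnSide : Side → Carrier → Set ℓ
  OnSide left x = 0# < x
  OnSide right x = x < 0#

  side-of : ∀ x → ¬ (x ≈ 0#) → Σ Side λ σ → OnSide σ x
  side-of x x≉0 with STO.compare x 0#
  ... | tri< x<0 _ _ = right , x<0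
  ... | tri≈ _ x≈0 _ = ⊥-elim (x≉0 x≈0)
  ... | tri> _ _ 0<x = left , 0<x

  same-side⇒disjoint : ∀ A B K L {σ} → OnSide σ (orient A B K) → OnSide σ (orient A B L) →
                       ¬ (∃[ p ] (OnSegment p A B × OnSegment p K L))
  same-side⇒disjoint (a₁ , a₂) (b₁ , b₂) (k₁ , k₂) (l₁ , l₂) {σ} K-side L-side
                     (p , (t , _ , _ , p-on-AB) , (s , 0≤s , s≤1 , p-on-KL)) = on-line σ K-side L-side
    where
    A = (a₁ , a₂)
    B = (b₁ , b₂)
    on-line-eq : orient A B (k₁ , k₂) + s * (orient A B (l₁ , l₂) - orient A B (k₁ , k₂)) ≈ 0#
    on-line-eq = trans (sym (orient-affine a₁ a₂ b₁ b₂ k₁ k₂ l₁ l₂ s))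
      (trans (sym (orient-congʳ A B p-on-KL))
        (trans (orient-congʳ A B p-on-AB) (orient-on-line a₁ a₂ b₁ b₂ t)))
    on-line : ∀ σ → OnSide σ (orient A B (k₁ , k₂)) → OnSide σ (orient A B (l₁ , l₂)) → ⊥
    on-line left K-side L-side = between-positives-nonzero _ _ s K-side L-side 0≤s s≤1 on-line-eq
    on-line right K-side L-side = between-negatives-nonzero _ _ s K-side L-side 0≤s s≤1 on-line-eq

  start-on-segment : ∀ A B → OnSegment A A B
  start-on-segment (a₁ , a₂) (b₁ , b₂) = 0# , inj₂ refl , inj₁ 0<1 ,
    sym (trans (+-congˡ (zeroˡ _)) (+-identityʳ _)) ,
    sym (trans (+-congˡ (zeroˡ _)) (+-identityʳ _))

  end-on-segment : ∀ A B → OnSegment B A B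
  end-on-segment (a₁ , a₂) (b₁ , b₂) = 1# , inj₁ 0<1 , inj₂ refl ,
    sym (trans (+-congˡ (*-identityˡ _)) (a+[b-a]≈b a₁ b₁)) ,
    sym (trans (+-congˡ (*-identityˡ _)) (a+[b-a]≈b a₂ b₂))
    where
    a+[b-a]≈b : ∀ a b → a + (b - a) ≈ b
    a+[b-a]≈b = solve 2 (λ a b → a :+ (b :- a) := b) refl

-- Fin 3 as a cyclic group of "levels" (used by the triple-system
-- constructions) and as the set of positions in a triple.
module ThreeElements where
  open import Relation.Binary.PropositionalEquality using (refl; sym)

  next : Fin 3 → Fin 3
  next 0F = 1F
  next 1F = 2F
  next 2F = 0F

  next-≢ : ∀ i → next i ≢ i
  next-≢ 0F ()
  next-≢ 1F ()
  next-≢ 2F ()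

  next²-≢ : ∀ i → i ≢ next (next i)
  next²-≢ 0F ()
  next²-≢ 1F ()
  next²-≢ 2F ()

  next³ : ∀ i → next (next (next i)) ≡ i
  next³ 0F = refl
  next³ 1F = refl
  next³ 2F = refl

  relative-position : ∀ i j → i ≡ j ⊎ j ≡ next i ⊎ i ≡ next j
  relative-position 0F 0F = inj₁ refl
  relative-position 0F 1F = inj₂ (inj₁ refl)
  relative-position 0F 2F = inj₂ (inj₂ refl)
  relative-position 1F 0F = inj₂ (inj₂ refl)
  relative-position 1F 1F = inj₁ refl
  relative-position 1F 2F = inj₂ (inj₁ refl)
  relative-position 2F 0F = inj₂ (inj₁ refl)
  relative-position 2F 1F = inj₂ (inj₂ refl)
  relative-position 2F 2F = inj₁ refl

  predecessor : ∀ {i j : Fin 3} → i ≢ j → j ≢ next i → i ≡ next j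
  predecessor {i} {j} i≢j j≢next-i with relative-position i j
  ... | inj₁ i≡j = ⊥-elim (i≢j i≡j)
  ... | inj₂ (inj₁ j≡next-i) = ⊥-elim (j≢next-i j≡next-i)
  ... | inj₂ (inj₂ i≡next-j) = i≡next-j

  other : Fin 3 → Fin 3 → Fin 3
  other 0F 1F = 2F
  other 1F 0F = 2F
  other 0F 2F = 1F
  other 2F 0F = 1F
  other 1F 2F = 0F
  other 2F 1F = 0F
  other i _ = i

  other-fresh : ∀ {i j : Fin 3} → i ≢ j → other i j ≢ i × other i j ≢ j
  other-fresh {0F} {0F} i≢j = ⊥-elim (i≢j refl)
  other-fresh {0F} {1F} _ = (λ ()) , (λ ())
  other-fresh {0F} {2F} _ = (λ ()) , (λ ())
  other-fresh {1F} {0F} _ = (λ ()) , (λ ())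
  other-fresh {1F} {1F} i≢j = ⊥-elim (i≢j refl)
  other-fresh {1F} {2F} _ = (λ ()) , (λ ())
  other-fresh {2F} {0F} _ = (λ ()) , (λ ())
  other-fresh {2F} {1F} _ = (λ ()) , (λ ())
  other-fresh {2F} {2F} i≢j = ⊥-elim (i≢j refl)

  private
    is-0 : ∀ {p : Fin 3} → p ≢ 1F → p ≢ 2F → p ≡ 0F
    is-0 {0F} _ _ = refl
    is-0 {1F} p≢1 _ = ⊥-elim (p≢1 refl)
    is-0 {2F} _ p≢2 = ⊥-elim (p≢2 refl)

    is-1 : ∀ {p : Fin 3} → p ≢ 0F → p ≢ 2F → p ≡ 1F
    is-1 {0F} p≢0 _ = ⊥-elim (p≢0 refl)
    is-1 {1F} _ _ = refl
    is-1 {2F} _ p≢2 = ⊥-elim (p≢2 refl)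

    is-2 : ∀ {p : Fin 3} → p ≢ 0F → p ≢ 1F → p ≡ 2F
    is-2 {0F} p≢0 _ = ⊥-elim (p≢0 refl)
    is-2 {1F} _ p≢1 = ⊥-elim (p≢1 refl)
    is-2 {2F} _ _ = refl

  other-unique : ∀ {i j p : Fin 3} → i ≢ j → p ≢ i → p ≢ j → p ≡ other i j
  other-unique {0F} {0F} i≢j _ _ = ⊥-elim (i≢j refl)
  other-unique {0F} {1F} _ p≢i p≢j = is-2 p≢i p≢j
  other-unique {0F} {2F} _ p≢i p≢j = is-1 p≢i p≢j
  other-unique {1F} {0F} _ p≢i p≢j = is-2 p≢j p≢i
  other-unique {1F} {1F} i≢j _ _ = ⊥-elim (i≢j refl)
  other-unique {1F} {2F} _ p≢i p≢j = is-0 p≢i p≢j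
  other-unique {2F} {0F} _ p≢i p≢j = is-1 p≢j p≢i
  other-unique {2F} {1F} _ p≢i p≢j = is-0 p≢j p≢i
  other-unique {2F} {2F} i≢j _ _ = ⊥-elim (i≢j refl)

  other-comm : ∀ {i j : Fin 3} → i ≢ j → other i j ≡ other j i
  other-comm i≢j = other-unique (λ e → i≢j (sym e)) (proj₂ (other-fresh i≢j)) (proj₁ (other-fresh i≢j))

  other-involutive : ∀ {i j : Fin 3} → i ≢ j → other i (other i j) ≡ j
  other-involutive {i} {j} i≢j = sym (other-unique (λ e → proj₁ (other-fresh i≢j) (sym e))
    (λ e → i≢j (sym e)) (λ e → proj₂ (other-fresh i≢j) (sym e)))

-- Triples over a type with decidable equality, as 3-element multisets.
module Triples {A : Set} (_≟_ : DecidableEquality A) where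
  open import Relation.Nullary.Decidable using (_⊎-dec_)
  open import Relation.Binary.PropositionalEquality using (refl; sym; trans)
  open ThreeElements using (other-unique)

  Triple : Set
  Triple = A × A × A

  _∈₃_ : A → Triple → Set
  z ∈₃ (a , b , c) = z ≡ a ⊎ z ≡ b ⊎ z ≡ c

  pattern at₁ = inj₁ refl
  pattern at₂ = inj₂ (inj₁ refl)
  pattern at₃ = inj₂ (inj₂ refl)

  _∈₃?_ : ∀ z T → Dec (z ∈₃ T)
  z ∈₃? (a , b , c) = (z ≟ a) ⊎-dec ((z ≟ b) ⊎-dec (z ≟ c))

  _⊆₃_ : Triple → Triple → Set
  T ⊆₃ T' = ∀ {z} → z ∈₃ T → z ∈₃ T'

  ⊆₃-intro : ∀ {a b c T} → a ∈₃ T → b ∈₃ T → c ∈₃ T → (a , b , c) ⊆₃ T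
  ⊆₃-intro ma mb mc at₁ = ma
  ⊆₃-intro ma mb mc at₂ = mb
  ⊆₃-intro ma mb mc at₃ = mc

  position : ∀ {z T} → z ∈₃ T → Fin 3
  position (inj₁ _) = 0F
  position (inj₂ (inj₁ _)) = 1F
  position (inj₂ (inj₂ _)) = 2F

  position-injective : ∀ {x y T} (mx : x ∈₃ T) (my : y ∈₃ T) → position mx ≡ position my → x ≡ y
  position-injective at₁ at₁ _ = refl
  position-injective at₂ at₂ _ = refl
  position-injective at₃ at₃ _ = refl
  position-injective at₁ at₂ ()
  position-injective at₁ at₃ ()
  position-injective at₂ at₁ ()
  position-injective at₂ at₃ ()
  position-injective at₃ at₁ ()
  position-injective at₃ at₂ ()

  -- Besides two distinct members a, b a triple has at most one member:
  -- its position is the one left over by those of a and b.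
  outside-pair-unique : ∀ {T a b w e} → a ∈₃ T → b ∈₃ T → w ∈₃ T → e ∈₃ T → a ≢ b →
                        w ≢ a → w ≢ b → e ≢ a → e ≢ b → w ≡ e
  outside-pair-unique ma mb mw me a≢b w≢a w≢b e≢a e≢b = position-injective mw me
    (trans (other-unique (distinct a≢b ma mb) (distinct w≢a mw ma) (distinct w≢b mw mb))
      (sym (other-unique (distinct a≢b ma mb) (distinct e≢a me ma) (distinct e≢b me mb))))
    where
    distinct : ∀ {x y T} → x ≢ y → (mx : x ∈₃ T) (my : y ∈₃ T) → position mx ≢ position my
    distinct x≢y mx my e = x≢y (position-injective mx my e)

  in-pair : ∀ {T a b w e} → a ∈₃ T → b ∈₃ T → w ∈₃ T → e ∈₃ T → a ≢ b →
            w ≢ a → w ≢ b → w ≢ e → e ≡ a ⊎ e ≡ b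
  in-pair {a = a} {b} {e = e} ma mb mw me a≢b w≢a w≢b w≢e with e ≟ a | e ≟ b
  ... | yes e≡a | _ = inj₁ e≡a
  ... | no _ | yes e≡b = inj₂ e≡b
  ... | no e≢a | no e≢b = ⊥-elim (w≢e (outside-pair-unique ma mb mw me a≢b w≢a w≢b e≢a e≢b))

  pairs-meet : ∀ {T a b a' b'} → a ∈₃ T → b ∈₃ T → a' ∈₃ T → b' ∈₃ T → a ≢ b → a' ≢ b' →
               a' ≡ a ⊎ a' ≡ b ⊎ b' ≡ a ⊎ b' ≡ b
  pairs-meet {a = a} {b} {a'} ma mb ma' mb' a≢b a'≢b' with a' ≟ a | a' ≟ b
  ... | yes e | _ = inj₁ e
  ... | no _ | yes e = inj₂ (inj₁ e)
  ... | no a'≢a | no a'≢b with in-pair ma mb ma' mb' a≢b a'≢a a'≢b a'≢b'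
  ...   | inj₁ e = inj₂ (inj₂ (inj₁ e))
  ...   | inj₂ e = inj₂ (inj₂ (inj₂ e))

  vertex : Fin 3 → Triple → A
  vertex 0F (x , _ , _) = x
  vertex 1F (_ , y , _) = y
  vertex 2F (_ , _ , z) = z

  vertex-∈ : ∀ i T → vertex i T ∈₃ T
  vertex-∈ 0F T = at₁
  vertex-∈ 1F T = at₂
  vertex-∈ 2F T = at₃

  opposite : ∀ {x y z a b} → x ≢ y → x ≢ z → y ≢ z →
             a ∈₃ (x , y , z) → b ∈₃ (x , y , z) → a ≢ b →
             Σ (Fin 3) λ i → vertex i (x , y , z) ≢ a × vertex i (x , y , z) ≢ b
  opposite x≢y x≢z y≢z at₁ at₁ a≢b = ⊥-elim (a≢b refl)
  opposite x≢y x≢z y≢z at₁ at₂ a≢b = 2F , ≢-sym x≢z , ≢-sym y≢z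
  opposite x≢y x≢z y≢z at₁ at₃ a≢b = 1F , ≢-sym x≢y , y≢z
  opposite x≢y x≢z y≢z at₂ at₁ a≢b = 2F , ≢-sym y≢z , ≢-sym x≢z
  opposite x≢y x≢z y≢z at₂ at₂ a≢b = ⊥-elim (a≢b refl)
  opposite x≢y x≢z y≢z at₂ at₃ a≢b = 0F , x≢y , x≢z
  opposite x≢y x≢z y≢z at₃ at₁ a≢b = 1F , y≢z , ≢-sym x≢y
  opposite x≢y x≢z y≢z at₃ at₂ a≢b = 0F , x≢z , x≢y
  opposite x≢y x≢z y≢z at₃ at₃ a≢b = ⊥-elim (a≢b refl)

  edge-determined : ∀ {T a b a' b'} i → a ∈₃ T → b ∈₃ T → a' ∈₃ T → b' ∈₃ T → a ≢ b → a' ≢ b' →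
                    vertex i T ≢ a → vertex i T ≢ b → vertex i T ≢ a' → vertex i T ≢ b' →
                    (a' ≡ a × b' ≡ b) ⊎ (a' ≡ b × b' ≡ a)
  edge-determined {T} i ma mb ma' mb' a≢b a'≢b' v≢a v≢b v≢a' v≢b'
    with in-pair ma mb (vertex-∈ i T) ma' a≢b v≢a v≢b v≢a'
       | in-pair ma mb (vertex-∈ i T) mb' a≢b v≢a v≢b v≢b'
  ... | inj₁ a'≡a | inj₁ b'≡a = ⊥-elim (a'≢b' (trans a'≡a (sym b'≡a)))
  ... | inj₁ a'≡a | inj₂ b'≡b = inj₁ (a'≡a , b'≡b)
  ... | inj₂ a'≡b | inj₁ b'≡a = inj₂ (a'≡b , b'≡a)
  ... | inj₂ a'≡b | inj₂ b'≡b = ⊥-elim (a'≢b' (trans a'≡b (sym b'≡b)))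

module SteinerTriples where
  open import Function.Bundles using (Inverse)
  open import Relation.Binary.PropositionalEquality using (sym; trans; cong; module ≡-Reasoning)

  -- A Steiner triple system on P, given by its "third point" operation: the
  -- blocks are the sets {a, b, third a b}, so every pair of distinct points
  -- lies in exactly one block.
  record SteinerTripleSystem (P : Set) : Set where
    field
      third            : P → P → P
      third-≢ˡ         : ∀ {a b} → a ≢ b → third a b ≢ a
      third-≢ʳ         : ∀ {a b} → a ≢ b → third a b ≢ b
      third-comm       : ∀ {a b} → a ≢ b → third a b ≡ third b a
      third-involutive : ∀ {a b} → a ≢ b → third a (third a b) ≡ b

  transport : ∀ {A B : Set} → A ↔ B → SteinerTripleSystem B → SteinerTripleSystem A
  transport {A} A↔B S = record
    { third = third′
    ; third-≢ˡ = λ a≢b e → third-≢ˡ (to-≢ a≢b) (to-from e)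
    ; third-≢ʳ = λ a≢b e → third-≢ʳ (to-≢ a≢b) (to-from e)
    ; third-comm = λ a≢b → cong from (third-comm (to-≢ a≢b))
    ; third-involutive = involutive
    }
    where
    open Inverse A↔B using (to; from; strictlyInverseˡ; strictlyInverseʳ)
    open SteinerTripleSystem S
    third′ : A → A → A
    third′ a b = from (third (to a) (to b))
    to-≢ : ∀ {a b} → a ≢ b → to a ≢ to b
    to-≢ {a} {b} a≢b e =
      a≢b (trans (sym (strictlyInverseʳ a)) (trans (cong from e) (strictlyInverseʳ b)))
    to-from : ∀ {x a} → from x ≡ a → x ≡ to a
    to-from {x} e = trans (sym (strictlyInverseˡ x)) (cong to e)
    involutive : ∀ {a b} → a ≢ b → third′ a (third′ a b) ≡ b
    involutive {a} {b} a≢b = begin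
      from (third (to a) (to (from (third (to a) (to b)))))
        ≡⟨ cong (λ x → from (third (to a) x)) (strictlyInverseˡ _) ⟩
      from (third (to a) (third (to a) (to b)))  ≡⟨ cong from (third-involutive (to-≢ a≢b)) ⟩
      from (to b)                                ≡⟨ strictlyInverseʳ b ⟩
      b ∎
      where open ≡-Reasoning

open SteinerTriples using (SteinerTripleSystem; transport)

-- Enumerating a decidable subset of Fin N: some Fin m is in bijection with
-- { j | P j }.  This is how the triangles of a triple system become colours.
module Enumerations where
  open import Relation.Unary using (Decidable)
  open import Relation.Binary.PropositionalEquality using (refl; sym; trans; cong; subst)

  record Enumeration {N : ℕ} (P : Fin N → Set) (m : ℕ) : Set where
    field
      rank        : ∀ j → P j → Fin m
      unrank      : Fin m → Fin N
      unrank-∈    : ∀ r → P (unrank r)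
      rank-unrank : ∀ r p → rank (unrank r) p ≡ r
      unrank-rank : ∀ j p → unrank (rank j p) ≡ j

    rank-irrelevant : ∀ j p p' → rank j p ≡ rank j p'
    rank-irrelevant j p p' =
      trans (sym (rank-unrank (rank j p) (subst P (sym e) p'))) (transported e p')
      where
      e = unrank-rank j p
      transported : ∀ {j j'} (e : j' ≡ j) p' → rank j' (subst P (sym e) p') ≡ rank j p'
      transported refl p' = refl

  enumerate : ∀ N (P : Fin N → Set) → Decidable P → Σ ℕ (Enumeration P)
  enumerate zero P P? = 0 , record
    { rank = λ () ; unrank = λ () ; unrank-∈ = λ () ; rank-unrank = λ () ; unrank-rank = λ () }
  enumerate (suc N) P P? with enumerate N (λ j → P (suc j)) (λ j → P? (suc j)) | P? zero
  ... | m , E | yes p₀ = suc m , record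
    { rank = rank′ ; unrank = unrank′ ; unrank-∈ = unrank′-∈
    ; rank-unrank = rank-unrank′ ; unrank-rank = unrank-rank′ }
    where
    open Enumeration E
    rank′ : ∀ j → P j → Fin (suc m)
    rank′ zero _ = zero
    rank′ (suc j) p = suc (rank j p)
    unrank′ : Fin (suc m) → Fin (suc N)
    unrank′ zero = zero
    unrank′ (suc r) = suc (unrank r)
    unrank′-∈ : ∀ r → P (unrank′ r)
    unrank′-∈ zero = p₀
    unrank′-∈ (suc r) = unrank-∈ r
    rank-unrank′ : ∀ r p → rank′ (unrank′ r) p ≡ r
    rank-unrank′ zero p = refl
    rank-unrank′ (suc r) p = cong suc (rank-unrank r p)
    unrank-rank′ : ∀ j p → unrank′ (rank′ j p) ≡ j
    unrank-rank′ zero p = refl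
    unrank-rank′ (suc j) p = cong suc (unrank-rank j p)
  ... | m , E | no ¬p₀ = m , record
    { rank = rank′ ; unrank = λ r → suc (unrank r) ; unrank-∈ = unrank-∈
    ; rank-unrank = rank-unrank ; unrank-rank = unrank-rank′ }
    where
    open Enumeration E
    rank′ : ∀ j → P j → Fin m
    rank′ zero p = ⊥-elim (¬p₀ p)
    rank′ (suc j) p = rank j p
    unrank-rank′ : ∀ j p → suc (unrank (rank′ j p)) ≡ j
    unrank-rank′ zero p = ⊥-elim (¬p₀ p)
    unrank-rank′ (suc j) p = cong suc (unrank-rank j p)

-- Fin (n choose 2) injects into the segments on n points: a segment of
-- n + 1 points either ends at the new point n or is a segment of n points.
module SegmentCount where
  open import Data.Nat using (_+_; _<_)
  open import Data.Nat.Combinatorics using (nCk+nC[k+1]≡[n+1]C[k+1]; nC1≡n)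
  open import Data.Fin using (inject₁; fromℕ; splitAt; join; cast)
  open import Relation.Binary.PropositionalEquality using (refl; sym; trans; cong; subst; subst₂)

  segment-≡ : ∀ {n} {a b a' b' : Fin n} (p : a Fin.< b) (p' : a' Fin.< b') →
              a ≡ a' → b ≡ b' → _≡_ {A = Segment n} ((a , b) , p) ((a' , b') , p')
  segment-≡ p p' refl refl = cong (λ q → (_ , q)) (FinP.<-irrelevant p p')

  C2-suc : ∀ n → suc n C 2 ≡ n + n C 2
  C2-suc n = trans (sym (nCk+nC[k+1]≡[n+1]C[k+1] n 1)) (cong (_+ n C 2) (nC1≡n n))

  start end : ∀ {n} → Segment n → ℕ
  start s = toℕ (proj₁ (proj₁ s))
  end s = toℕ (proj₂ (proj₁ s))

  inject : ∀ {n} → Segment n → Segment (suc n)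
  inject ((a , b) , a<b) = (inject₁ a , inject₁ b) ,
    subst₂ _<_ (sym (FinP.toℕ-inject₁ a)) (sym (FinP.toℕ-inject₁ b)) a<b

  to-last : ∀ {n} → Fin n → Segment (suc n)
  to-last {n} i = (inject₁ i , fromℕ n) ,
    subst₂ _<_ (sym (FinP.toℕ-inject₁ i)) (sym (FinP.toℕ-fromℕ n)) (FinP.toℕ<n i)

  inject-end : ∀ {n} (s : Segment n) → end (inject s) < n
  inject-end {n} ((a , b) , _) = subst (_< n) (sym (FinP.toℕ-inject₁ b)) (FinP.toℕ<n b)

  inject-injective : ∀ {n} (s s' : Segment n) → inject s ≡ inject s' → s ≡ s'
  inject-injective ((a , b) , p) ((a' , b') , p') e = segment-≡ p p'
    (FinP.toℕ-injective (trans (sym (FinP.toℕ-inject₁ a)) (trans (cong start e) (FinP.toℕ-inject₁ a'))))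
    (FinP.toℕ-injective (trans (sym (FinP.toℕ-inject₁ b)) (trans (cong end e) (FinP.toℕ-inject₁ b'))))

  segment-of : ∀ n → Fin (n C 2) → Segment n
  segment-of-split : ∀ n → Fin n ⊎ Fin (n C 2) → Segment (suc n)
  segment-of zero ()
  segment-of (suc n) i = segment-of-split n (splitAt n (cast (C2-suc n) i))
  segment-of-split n (inj₁ i) = to-last i
  segment-of-split n (inj₂ j) = inject (segment-of n j)

  segment-of-injective : ∀ n i j → segment-of n i ≡ segment-of n j → i ≡ j
  segment-of-split-injective : ∀ n x y → segment-of-split n x ≡ segment-of-split n y → x ≡ y
  segment-of-injective zero () j e
  segment-of-injective (suc n) i j e = FinP.toℕ-injective
    (trans (sym (FinP.toℕ-cast (C2-suc n) i)) (trans (cong toℕ cast-≡) (FinP.toℕ-cast (C2-suc n) j)))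
    where
    cast-≡ : cast (C2-suc n) i ≡ cast (C2-suc n) j
    cast-≡ = trans (sym (FinP.join-splitAt n (n C 2) _))
      (trans (cong (join n (n C 2)) (segment-of-split-injective n _ _ e)) (FinP.join-splitAt n (n C 2) _))
  segment-of-split-injective n (inj₁ i) (inj₁ i') e = cong inj₁ (FinP.toℕ-injective
    (trans (sym (FinP.toℕ-inject₁ i)) (trans (cong start e) (FinP.toℕ-inject₁ i'))))
  segment-of-split-injective n (inj₁ i) (inj₂ j) e = ⊥-elim (ℕP.<-irrefl
    (trans (sym (cong end e)) (FinP.toℕ-fromℕ n)) (inject-end (segment-of n j)))
  segment-of-split-injective n (inj₂ j) (inj₁ i) e = ⊥-elim (ℕP.<-irrefl
    (trans (cong end e) (FinP.toℕ-fromℕ n)) (inject-end (segment-of n j)))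
  segment-of-split-injective n (inj₂ j) (inj₂ j') e =
    cong inj₂ (segment-of-injective n j j' (inject-injective _ _ e))

module Segments {n : ℕ} where
  open import Relation.Binary.Definitions using (tri<; tri≈; tri>)
  open import Relation.Binary.PropositionalEquality using (refl)

  first second : Segment n → Fin n
  first s = proj₁ (proj₁ s)
  second s = proj₂ (proj₁ s)

  first≢second : ∀ s → first s ≢ second s
  first≢second (_ , a<b) = FinP.<⇒≢ a<b

  Joins : Segment n → Fin n → Fin n → Set
  Joins s u w = (first s ≡ u × second s ≡ w) ⊎ (first s ≡ w × second s ≡ u)

  segment : ∀ u w → u ≢ w → Σ (Segment n) λ s → Joins s u w
  segment u w u≢w with FinP.<-cmp u w
  ... | tri< u<w _ _ = ((u , w) , u<w) , inj₁ (refl , refl)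
  ... | tri≈ _ u≡w _ = ⊥-elim (u≢w u≡w)
  ... | tri> _ _ w<u = ((w , u) , w<u) , inj₂ (refl , refl)

-- A triangle is
-- named by its "canonical pair" x < y < third x y, and colours are the
-- ranks of canonical pairs in an enumeration of Fin n × Fin n.
module TriangleColouring {n : ℕ} (S : SteinerTripleSystem (Fin n)) where
  open import Data.Nat using (_≤_; _*_)
  open import Data.Fin using (_<_; combine; remQuot)
  open import Relation.Nullary.Decidable using (_×-dec_)
  open import Relation.Binary.Definitions using (tri<; tri≈; tri>)
  open import Relation.Binary.PropositionalEquality using (refl; sym; trans; cong; subst; subst₂)
  open FinP using (<-cmp; <-trans; <-irrefl; <-asym; <⇒≢)
  open SteinerTripleSystem S
  open Triples (FinP._≟_ {n})
  open Enumerations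
  open Segments {n}

  triangle : Fin n → Fin n → Triple
  triangle a b = a , b , third a b

  third-of-third : ∀ {a b} → a ≢ b → third b (third a b) ≡ a
  third-of-third a≢b = trans (cong (third _) (third-comm a≢b)) (third-involutive (≢-sym a≢b))

  triangle-spanned : ∀ {a b x y} → a ≢ b → x ∈₃ triangle a b → y ∈₃ triangle a b → x ≢ y →
                     triangle a b ⊆₃ triangle x y
  triangle-spanned a≢b at₁ at₁ x≢y = ⊥-elim (x≢y refl)
  triangle-spanned a≢b at₁ at₂ x≢y = ⊆₃-intro at₁ at₂ at₃
  triangle-spanned a≢b at₁ at₃ x≢y = ⊆₃-intro at₁ (inj₂ (inj₂ (sym (third-involutive a≢b)))) at₂
  triangle-spanned a≢b at₂ at₁ x≢y = ⊆₃-intro at₂ at₁ (inj₂ (inj₂ (third-comm a≢b)))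
  triangle-spanned a≢b at₂ at₂ x≢y = ⊥-elim (x≢y refl)
  triangle-spanned a≢b at₂ at₃ x≢y = ⊆₃-intro (inj₂ (inj₂ (sym (third-of-third a≢b)))) at₁ at₂
  triangle-spanned a≢b at₃ at₁ x≢y =
    ⊆₃-intro at₂ (inj₂ (inj₂ (sym (trans (third-comm x≢y) (third-involutive a≢b))))) at₁
  triangle-spanned a≢b at₃ at₂ x≢y =
    ⊆₃-intro (inj₂ (inj₂ (sym (trans (third-comm x≢y) (third-of-third a≢b))))) at₂ at₁
  triangle-spanned a≢b at₃ at₃ x≢y = ⊥-elim (x≢y refl)

  Canonical : Fin n → Fin n → Set
  Canonical x y = x < y × y < third x y

  canonical-≢ : ∀ {x y} → Canonical x y → x ≢ y
  canonical-≢ (x<y , _) = <⇒≢ x<y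

  canonical-pair : ∀ {a b} → a < b →
    Σ (Fin n × Fin n) λ (x , y) → Canonical x y × x ∈₃ triangle a b × y ∈₃ triangle a b
  canonical-pair {a} {b} a<b with <-cmp b (third a b)
  ... | tri< b<c _ _ = (a , b) , (a<b , b<c) , at₁ , at₂
  ... | tri≈ _ b≡c _ = ⊥-elim (third-≢ʳ (<⇒≢ a<b) (sym b≡c))
  ... | tri> _ _ c<b with <-cmp a (third a b)
  ...   | tri< a<c _ _ = (a , third a b) ,
            (a<c , subst (third a b <_) (sym (third-involutive (<⇒≢ a<b))) c<b) , at₁ , at₃
  ...   | tri≈ _ a≡c _ = ⊥-elim (third-≢ˡ (<⇒≢ a<b) (sym a≡c))
  ...   | tri> _ _ c<a = (third a b , a) ,
            (c<a , subst (a <_) (sym (trans (third-comm (<⇒≢ c<a)) (third-involutive (<⇒≢ a<b)))) a<b) ,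
            at₃ , at₁

  canonical-unique₀ : ∀ {x y x' y'} → Canonical x y → Canonical x' y' →
                      x' ∈₃ triangle x y → y' ∈₃ triangle x y → x' ≡ x × y' ≡ y
  canonical-unique₀ _ (x<x , _) at₁ at₁ = ⊥-elim (<-irrefl refl x<x)
  canonical-unique₀ _ _ at₁ at₂ = refl , refl
  canonical-unique₀ (x<y , y<z) (_ , z<t) at₁ at₃ =
    ⊥-elim (<-asym y<z (subst (third _ _ <_) (third-involutive (<⇒≢ x<y)) z<t))
  canonical-unique₀ (x<y , _) (y<x , _) at₂ at₁ = ⊥-elim (<-asym x<y y<x)
  canonical-unique₀ _ (y<y , _) at₂ at₂ = ⊥-elim (<-irrefl refl y<y)
  canonical-unique₀ (x<y , y<z) (_ , z<t) at₂ at₃ =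
    ⊥-elim (<-asym (<-trans x<y y<z) (subst (third _ _ <_) (third-of-third (<⇒≢ x<y)) z<t))
  canonical-unique₀ (x<y , y<z) (z<x , _) at₃ at₁ = ⊥-elim (<-asym (<-trans x<y y<z) z<x)
  canonical-unique₀ (_ , y<z) (z<y , _) at₃ at₂ = ⊥-elim (<-asym y<z z<y)
  canonical-unique₀ _ (z<z , _) at₃ at₃ = ⊥-elim (<-irrefl refl z<z)

  -- canonical pairs inside one triangle coincide (any edge spans the triangle)
  canonical-unique : ∀ {a b x y x' y'} → a ≢ b → Canonical x y → Canonical x' y' →
                     x ∈₃ triangle a b → y ∈₃ triangle a b → x' ∈₃ triangle a b → y' ∈₃ triangle a b →
                     x' ≡ x × y' ≡ y
  canonical-unique a≢b q q' mx my mx' my' = canonical-unique₀ q q'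
    (triangle-spanned a≢b mx my (canonical-≢ q) mx') (triangle-spanned a≢b mx my (canonical-≢ q) my')

  CanonicalCode : Fin (n * n) → Set
  CanonicalCode j = Canonical (proj₁ (remQuot {n} n j)) (proj₂ (remQuot {n} n j))

  colours : Σ ℕ (Enumeration CanonicalCode)
  colours = enumerate (n * n) CanonicalCode
    (λ j → (proj₁ (remQuot {n} n j) FinP.<? proj₂ (remQuot {n} n j))
           ×-dec (proj₂ (remQuot {n} n j) FinP.<? third (proj₁ (remQuot {n} n j)) (proj₂ (remQuot {n} n j))))

  m : ℕ
  m = proj₁ colours

  open Enumeration (proj₂ colours)

  code : ∀ {x y} → Canonical x y → CanonicalCode (combine x y)
  code {x} {y} = subst (λ p → Canonical (proj₁ p) (proj₂ p)) (sym (FinP.remQuot-combine x y))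

  pair-colour : ∀ {x y} → Canonical x y → Fin m
  pair-colour {x} {y} q = rank (combine x y) (code q)

  pair-colour-cong : ∀ {x y x' y'} (q : Canonical x y) (q' : Canonical x' y') →
                     x ≡ x' → y ≡ y' → pair-colour q ≡ pair-colour q'
  pair-colour-cong q q' refl refl = rank-irrelevant _ _ _

  colour : Segment n → Fin m
  colour (_ , a<b) = pair-colour (proj₁ (proj₂ (canonical-pair a<b)))

  cx cy : Fin m → Fin n
  cx r = proj₁ (remQuot {n} n (unrank r))
  cy r = proj₂ (remQuot {n} n (unrank r))

  colour-canonical : ∀ r → Canonical (cx r) (cy r)
  colour-canonical = unrank-∈

  colour-triangle : Fin m → Triple
  colour-triangle r = triangle (cx r) (cy r)

  pair-colour-of-colour : ∀ r → pair-colour (colour-canonical r) ≡ r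
  pair-colour-of-colour r = trans (rank-irrelevant _ _ _)
    (trans (transported (FinP.combine-remQuot {n} n (unrank r))) (rank-unrank r (colour-canonical r)))
    where
    transported : ∀ {j} (e : j ≡ unrank r) →
                  rank j (subst CanonicalCode (sym e) (colour-canonical r)) ≡ rank (unrank r) (colour-canonical r)
    transported refl = refl

  colour-of-pair : ∀ {x y} (q : Canonical x y) → cx (pair-colour q) ≡ x × cy (pair-colour q) ≡ y
  colour-of-pair {x} {y} q = cong proj₁ e , cong proj₂ e
    where e = trans (cong (remQuot {n} n) (unrank-rank _ (code q))) (FinP.remQuot-combine x y)

  EdgeOf : Triple → Segment n → Set
  EdgeOf T s = first s ∈₃ T × second s ∈₃ T

  colour-of-edge : ∀ r s → EdgeOf (colour-triangle r) s → colour s ≡ r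
  colour-of-edge r ((a , b) , a<b) (ma , mb) with canonical-pair a<b
  ... | (x , y) , q , mx , my = trans (pair-colour-cong q (colour-canonical r) x≡ y≡) (pair-colour-of-colour r)
    where
    spanned = triangle-spanned (canonical-≢ (colour-canonical r)) ma mb (<⇒≢ a<b)
    same = canonical-unique (<⇒≢ a<b) q (colour-canonical r) mx my (spanned at₁) (spanned at₂)
    x≡ = sym (proj₁ same)
    y≡ = sym (proj₂ same)

  edge-of-colour : ∀ s → EdgeOf (colour-triangle (colour s)) s
  edge-of-colour ((a , b) , a<b) with canonical-pair a<b
  ... | (x , y) , q , mx , my = relabel (spanned at₁) , relabel (spanned at₂)
    where
    spanned = triangle-spanned (<⇒≢ a<b) mx my (canonical-≢ q)
    relabel : ∀ {u} → u ∈₃ triangle x y → u ∈₃ colour-triangle (pair-colour q)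
    relabel = subst₂ (λ x y → _ ∈₃ triangle x y) (sym (proj₁ (colour-of-pair q))) (sym (proj₂ (colour-of-pair q)))

  colour-surjective : ∀ r → Σ (Segment n) λ s → colour s ≡ r
  colour-surjective r = s , colour-of-edge r s (at₁ , at₂)
    where s = (cx r , cy r) , proj₁ (colour-canonical r)

  same-colour-meet : ∀ s s' → colour s ≡ colour s' →
                     first s' ≡ first s ⊎ first s' ≡ second s ⊎ second s' ≡ first s ⊎ second s' ≡ second s
  same-colour-meet s s' e = pairs-meet (proj₁ (edge-of-colour s)) (proj₂ (edge-of-colour s))
    (subst (λ r → _ ∈₃ colour-triangle r) (sym e) (proj₁ (edge-of-colour s')))
    (subst (λ r → _ ∈₃ colour-triangle r) (sym e) (proj₂ (edge-of-colour s')))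
    (first≢second s) (first≢second s')

  colour-triangle-distinct : ∀ r → cx r ≢ cy r × cx r ≢ third (cx r) (cy r) × cy r ≢ third (cx r) (cy r)
  colour-triangle-distinct r =
    x≢y , (λ e → third-≢ˡ x≢y (sym e)) , (λ e → third-≢ʳ x≢y (sym e))
    where x≢y = canonical-≢ (colour-canonical r)

  joins-edge : ∀ T s {u w} → Joins s u w → u ∈₃ T → w ∈₃ T → EdgeOf T s
  joins-edge _ _ (inj₁ (refl , refl)) mu mw = mu , mw
  joins-edge _ _ (inj₂ (refl , refl)) mu mw = mw , mu

  colours-meet-once : ∀ r r' {u w} → u ≢ w → u ∈₃ colour-triangle r → w ∈₃ colour-triangle r →
                      u ∈₃ colour-triangle r' → w ∈₃ colour-triangle r' → r ≡ r'
  colours-meet-once r r' {u} {w} u≢w mu mw mu' mw' with segment u w u≢w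
  ... | s , joins = trans (sym (colour-of-edge r s (joins-edge (colour-triangle r) s joins mu mw)))
                          (colour-of-edge r' s (joins-edge (colour-triangle r') s joins mu' mw'))

  avoiding-edge : ∀ r r' → r ≢ r' → Σ (Segment n) λ s → colour s ≡ r ×
                  ¬ (first s ∈₃ colour-triangle r') × ¬ (second s ∈₃ colour-triangle r')
  avoiding-edge r r' r≢r' =
    by-membership (cx r ∈₃? T') (cy r ∈₃? T') (third (cx r) (cy r) ∈₃? T')
    where
    T' = colour-triangle r'
    x≢y = proj₁ (colour-triangle-distinct r)
    x≢z = proj₁ (proj₂ (colour-triangle-distinct r))
    y≢z = proj₂ (proj₂ (colour-triangle-distinct r))
    edge : ∀ {u w} → u ≢ w → u ∈₃ colour-triangle r → w ∈₃ colour-triangle r →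
           ¬ (u ∈₃ T') → ¬ (w ∈₃ T') → Σ (Segment n) λ s → colour s ≡ r × ¬ (first s ∈₃ T') × ¬ (second s ∈₃ T')
    edge {u} {w} u≢w mu mw ¬mu ¬mw with segment u w u≢w
    ... | s , inj₁ (refl , refl) = s , colour-of-edge r s (mu , mw) , ¬mu , ¬mw
    ... | s , inj₂ (refl , refl) = s , colour-of-edge r s (mw , mu) , ¬mw , ¬mu
    by-membership : Dec (cx r ∈₃ T') → Dec (cy r ∈₃ T') → Dec (third (cx r) (cy r) ∈₃ T') →
                    Σ (Segment n) λ s → colour s ≡ r × ¬ (first s ∈₃ T') × ¬ (second s ∈₃ T')
    by-membership (yes mx) (yes my) _        = ⊥-elim (r≢r' (colours-meet-once r r' x≢y at₁ at₂ mx my))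
    by-membership (yes mx) (no _)   (yes mz) = ⊥-elim (r≢r' (colours-meet-once r r' x≢z at₁ at₃ mx mz))
    by-membership (yes _)  (no ¬my) (no ¬mz) = edge y≢z at₂ at₃ ¬my ¬mz
    by-membership (no _)   (yes my) (yes mz) = ⊥-elim (r≢r' (colours-meet-once r r' y≢z at₂ at₃ my mz))
    by-membership (no ¬mx) (yes _)  (no ¬mz) = edge x≢z at₁ at₃ ¬mx ¬mz
    by-membership (no ¬mx) (no ¬my) _        = edge x≢y at₁ at₂ ¬mx ¬my

  -- Counting: a segment is determined by its colour and the vertex of its
  -- triangle opposite to it, so (n choose 2) ≤ 3 m.
  Off : Fin n → Segment n → Set
  Off v s = v ≢ first s × v ≢ second s

  opposite-of : ∀ s → Σ (Fin 3) λ i → Off (vertex i (colour-triangle (colour s))) s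
  opposite-of s with colour-triangle-distinct (colour s)
  ... | x≢y , x≢z , y≢z =
    opposite x≢y x≢z y≢z (proj₁ (edge-of-colour s)) (proj₂ (edge-of-colour s)) (first≢second s)

  -- two edges of T off the same vertex are equal (the ordering excludes swapping)
  edge-by-opposite : ∀ T i s s' → EdgeOf T s → EdgeOf T s' →
                     Off (vertex i T) s → Off (vertex i T) s' → s ≡ s'
  edge-by-opposite T i s@(_ , a<b) s'@(_ , a'<b') (ma , mb) (ma' , mb') (v≢a , v≢b) (v≢a' , v≢b')
    with edge-determined i ma mb ma' mb' (first≢second s) (first≢second s') v≢a v≢b v≢a' v≢b'
  ... | inj₁ (refl , refl) = SegmentCount.segment-≡ a<b a'<b' refl refl
  ... | inj₂ (refl , refl) = ⊥-elim (<-asym a<b a'<b')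

  label : Segment n → Fin (m * 3)
  label s = combine (colour s) (proj₁ (opposite-of s))

  label-injective : ∀ s s' → label s ≡ label s' → s ≡ s'
  label-injective s s' e with FinP.combine-injective (colour s) _ (colour s') _ e
  ... | same-colour , same-opposite = edge-by-opposite _ (proj₁ (opposite-of s)) s s'
    (edge-of-colour s)
    (subst (λ r → EdgeOf (colour-triangle r) s') (sym same-colour) (edge-of-colour s'))
    (proj₂ (opposite-of s))
    (subst₂ (λ r i → Off (vertex i (colour-triangle r)) s') (sym same-colour) (sym same-opposite)
      (proj₂ (opposite-of s')))

  enough-colours : (n C 2) / 3 ≤ m
  enough-colours = subst ((n C 2) / 3 ≤_) (m*n/n≡m m 3)
    (/-monoˡ-≤ 3 (FinP.injective⇒≤ {f = λ i → label (SegmentCount.segment-of n i)}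
      (λ {i} {j} e → SegmentCount.segment-of-injective n i j (label-injective _ _ e))))
    where open import Data.Nat.DivMod using (m*n/n≡m; /-monoˡ-≤)

module DisjointnessColouring {c ℓ : Level} (F : OrderedField c ℓ) {n : ℕ}
  (V : Fin n → Plane.Point F) (general : Plane.GeneralPosition F V)
  (S : SteinerTripleSystem (Fin n)) where
  open import Relation.Binary.PropositionalEquality using (refl)
  open Plane F
  open Orientation F
  open SteinerTripleSystem S
  open Triples (FinP._≟_ {n})
  open Segments {n}
  open TriangleColouring S

  meeting⇒not-disjoint : ∀ s s' →
    first s' ≡ first s ⊎ first s' ≡ second s ⊎ second s' ≡ first s ⊎ second s' ≡ second s →
    ¬ SegDisjoint V s s'
  meeting⇒not-disjoint _ _ (inj₁ refl) disjoint =
    disjoint (_ , start-on-segment _ _ , start-on-segment _ _)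
  meeting⇒not-disjoint _ _ (inj₂ (inj₁ refl)) disjoint =
    disjoint (_ , end-on-segment _ _ , start-on-segment _ _)
  meeting⇒not-disjoint _ _ (inj₂ (inj₂ (inj₁ refl))) disjoint =
    disjoint (_ , start-on-segment _ _ , end-on-segment _ _)
  meeting⇒not-disjoint _ _ (inj₂ (inj₂ (inj₂ refl))) disjoint =
    disjoint (_ , end-on-segment _ _ , end-on-segment _ _)

  -- same colour means a common endpoint, so adjacent segments get distinct colours
  proper : ∀ s s' → SegDisjoint V s s' → colour s ≢ colour s'
  proper s s' disjoint same = meeting⇒not-disjoint s s' (same-colour-meet s s' same) disjoint

  orientation : Segment n → Fin n → OrderedField.Carrier F
  orientation s k = orient (V (first s)) (V (second s)) (V k)

  side : ∀ s k → first s ≢ k → second s ≢ k → Σ Side λ σ → OnSide σ (orientation s k)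
  side s k first≢k second≢k =
    side-of (orientation s k) (general _ _ k (first≢second s) second≢k first≢k)

  same-side-edge : ∀ s T σ {u w} → u ≢ w → u ∈₃ T → w ∈₃ T →
                   OnSide σ (orientation s u) → OnSide σ (orientation s w) →
                   Σ (Segment n) λ s' → SegDisjoint V s s' × EdgeOf T s'
  same-side-edge s T σ {u} {w} u≢w mu mw u-side w-side with segment u w u≢w
  ... | s' , inj₁ (refl , refl) = s' , same-side⇒disjoint _ _ _ _ {σ} u-side w-side , mu , mw
  ... | s' , inj₂ (refl , refl) = s' , same-side⇒disjoint _ _ _ _ {σ} w-side u-side , mw , mu

  -- of the three vertices of a triangle avoiding s, two are on the same side
  disjoint-edge : ∀ s (T : Triple) → (∀ {v} → v ∈₃ T → first s ≢ v × second s ≢ v) →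
                  proj₁ T ≢ proj₁ (proj₂ T) → proj₁ T ≢ proj₂ (proj₂ T) → proj₁ (proj₂ T) ≢ proj₂ (proj₂ T) →
                  Σ (Segment n) λ s' → SegDisjoint V s s' × EdgeOf T s'
  disjoint-edge s T@(u , v , w) off u≢v u≢w v≢w
    with side s u (proj₁ (off at₁)) (proj₂ (off at₁))
       | side s v (proj₁ (off at₂)) (proj₂ (off at₂))
       | side s w (proj₁ (off at₃)) (proj₂ (off at₃))
  ... | left , hu  | left , hv  | _          = same-side-edge s T left u≢v at₁ at₂ hu hv
  ... | right , hu | right , hv | _          = same-side-edge s T right u≢v at₁ at₂ hu hv
  ... | left , hu  | right , _  | left , hw  = same-side-edge s T left u≢w at₁ at₃ hu hw
  ... | left , _   | right , hv | right , hw = same-side-edge s T right v≢w at₂ at₃ hv hw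
  ... | right , _  | left , hv  | left , hw  = same-side-edge s T left v≢w at₂ at₃ hv hw
  ... | right , hu | left , _   | right , hw = same-side-edge s T right u≢w at₁ at₃ hu hw

  avoids : ∀ s T → ¬ (first s ∈₃ T) → ¬ (second s ∈₃ T) →
           ∀ {v} → v ∈₃ T → first s ≢ v × second s ≢ v
  avoids s T first∉ second∉ mv = (λ { refl → first∉ mv }) , (λ { refl → second∉ mv })

  -- every two distinct colours are adjacent somewhere: an edge s of the first
  -- triangle avoids the second, which then has an edge disjoint from s
  complete : ∀ r r' → r ≢ r' → ∃[ s ] ∃[ s' ] (SegDisjoint V s s' × colour s ≡ r × colour s' ≡ r')
  complete r r' r≢r' with avoiding-edge r r' r≢r' | colour-triangle-distinct r'
  ... | s , colour-s , first∉ , second∉ | x≢y , x≢z , y≢z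
    with disjoint-edge s (colour-triangle r') (avoids s _ first∉ second∉) x≢y x≢z y≢z
  ... | s' , disjoint , edge = s , s' , disjoint , colour-s , colour-of-edge r' s' edge

  triangle-colouring : ((n C 2) / 3) ≤α[ V ]
  triangle-colouring = m , enough-colours , colour ,
    (λ r → proj₁ (colour-surjective r) , λ { refl → proj₂ (colour-surjective r) }) ,
    proper , complete

record CommutativeQuasigroup (Q : Set) : Set where
  infixl 7 _∙_
  infix 7 _\\_
  field
    _∙_    : Q → Q → Q
    _\\_   : Q → Q → Q
    ∙-comm : ∀ x y → x ∙ y ≡ y ∙ x
    ∙-\\   : ∀ x z → x ∙ (x \\ z) ≡ z
    \\-∙   : ∀ x w → x \\ (x ∙ w) ≡ w

  ∙-cancelˡ : ∀ x {w w'} → x ∙ w ≡ x ∙ w' → w ≡ w'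
  ∙-cancelˡ x {w} {w'} e = Eq.trans (Eq.sym (\\-∙ x w)) (Eq.trans (Eq.cong (x \\_) e) (\\-∙ x w'))
    where import Relation.Binary.PropositionalEquality as Eq

-- Bose's construction: an idempotent commutative quasigroup Q yields a
-- Steiner triple system on Q × Fin 3 with the triples
--   {(x,0), (x,1), (x,2)}  and  {(x,i), (y,i), (x ∙ y, i+1)}  for x ≢ y.
module Bose {Q : Set} (_≟_ : DecidableEquality Q) (G : CommutativeQuasigroup Q)
            (∙-idem : ∀ x → CommutativeQuasigroup._∙_ G x x ≡ x) where
  open import Relation.Binary.PropositionalEquality using (refl; sym; trans; cong; cong₂)
  open import Data.Fin.Properties using () renaming (_≟_ to _≟₃_)
  open ThreeElements
  open CommutativeQuasigroup G

  P : Set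
  P = Q × Fin 3

  -- by idempotence, x \\ y and x ∙ y differ from x when y ≢ x
  \\-≢ : ∀ {x y} → x ≢ y → x \\ y ≢ x
  \\-≢ {x} {y} x≢y e = x≢y (trans (sym (∙-idem x)) (trans (cong (x ∙_) (sym e)) (∙-\\ x y)))

  ∙-≢ : ∀ {x y} → x ≢ y → x ≢ x ∙ y
  ∙-≢ {x} {y} x≢y e = x≢y (sym (∙-cancelˡ x (trans (sym e) (sym (∙-idem x)))))

  data Relation (x y : Q) (i j : Fin 3) : Set where
    same-column : x ≡ y → i ≢ j → Relation x y i j
    same-level  : x ≢ y → i ≡ j → Relation x y i j
    next-level  : x ≢ y → j ≡ next i → Relation x y i j
    prev-level  : x ≢ y → i ≢ j → j ≢ next i → Relation x y i j

  relation : ∀ {x y i j} → (x , i) ≢ (y , j) → Relation x y i j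
  relation {x} {y} {i} {j} ne with x ≟ y | i ≟₃ j
  ... | yes refl | yes refl = ⊥-elim (ne refl)
  ... | yes x≡y | no i≢j = same-column x≡y i≢j
  ... | no x≢y | yes i≡j = same-level x≢y i≡j
  ... | no x≢y | no i≢j with j ≟₃ next i
  ...   | yes j≡next = next-level x≢y j≡next
  ...   | no j≢next = prev-level x≢y i≢j j≢next

  third : P → P → P
  third (x , i) (y , j) with x ≟ y | i ≟₃ j
  ... | yes _ | _ = (x , other i j)
  ... | no _ | yes _ = (x ∙ y , next i)
  ... | no _ | no _ with j ≟₃ next i
  ...   | yes _ = (x \\ y , i)
  ...   | no _ = (y \\ x , j)

  third-column : ∀ {x y i j} → x ≡ y → third (x , i) (y , j) ≡ (x , other i j)
  third-column {x} {y} x≡y with x ≟ y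
  ... | yes _ = refl
  ... | no x≢y = ⊥-elim (x≢y x≡y)

  third-level : ∀ {x y i j} → x ≢ y → i ≡ j → third (x , i) (y , j) ≡ (x ∙ y , next i)
  third-level {x} {y} {i} {j} x≢y i≡j with x ≟ y | i ≟₃ j
  ... | yes x≡y | _ = ⊥-elim (x≢y x≡y)
  ... | no _ | yes _ = refl
  ... | no _ | no i≢j = ⊥-elim (i≢j i≡j)

  third-next : ∀ {x y i j} → x ≢ y → j ≡ next i → third (x , i) (y , j) ≡ (x \\ y , i)
  third-next {x} {y} {i} {j} x≢y j≡next with x ≟ y | i ≟₃ j
  ... | yes x≡y | _ = ⊥-elim (x≢y x≡y)
  ... | no _ | yes i≡j = ⊥-elim (next-≢ i (trans (sym j≡next) (sym i≡j)))
  ... | no _ | no _ with j ≟₃ next i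
  ...   | yes _ = refl
  ...   | no j≢next = ⊥-elim (j≢next j≡next)

  third-prev : ∀ {x y i j} → x ≢ y → i ≢ j → j ≢ next i → third (x , i) (y , j) ≡ (y \\ x , j)
  third-prev {x} {y} {i} {j} x≢y i≢j j≢next with x ≟ y | i ≟₃ j
  ... | yes x≡y | _ = ⊥-elim (x≢y x≡y)
  ... | no _ | yes i≡j = ⊥-elim (i≢j i≡j)
  ... | no _ | no _ with j ≟₃ next i
  ...   | yes j≡next = ⊥-elim (j≢next j≡next)
  ...   | no _ = refl

  third-≢ˡ : ∀ {a b} → a ≢ b → third a b ≢ a
  third-≢ˡ {x , i} {y , j} ne with relation ne
  ... | same-column x≡y i≢j = λ e → proj₁ (other-fresh i≢j) (cong proj₂ (trans (sym (third-column x≡y)) e))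
  ... | same-level x≢y i≡j = λ e → next-≢ i (cong proj₂ (trans (sym (third-level x≢y i≡j)) e))
  ... | next-level x≢y j≡next = λ e → \\-≢ x≢y (cong proj₁ (trans (sym (third-next x≢y j≡next)) e))
  ... | prev-level x≢y i≢j j≢next = λ e → i≢j (sym (cong proj₂ (trans (sym (third-prev x≢y i≢j j≢next)) e)))

  third-≢ʳ : ∀ {a b} → a ≢ b → third a b ≢ b
  third-≢ʳ {x , i} {y , j} ne with relation ne
  ... | same-column x≡y i≢j = λ e → proj₂ (other-fresh i≢j) (cong proj₂ (trans (sym (third-column x≡y)) e))
  ... | same-level x≢y i≡j = λ e → next-≢ i (trans (cong proj₂ (trans (sym (third-level x≢y i≡j)) e)) (sym i≡j))
  ... | next-level x≢y j≡next = λ e → next-≢ i (sym (trans (cong proj₂ (trans (sym (third-next x≢y j≡next)) e)) j≡next))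
  ... | prev-level x≢y i≢j j≢next = λ e → \\-≢ (≢-sym x≢y) (cong proj₁ (trans (sym (third-prev x≢y i≢j j≢next)) e))

  third-comm : ∀ {a b} → a ≢ b → third a b ≡ third b a
  third-comm {x , i} {y , j} ne with relation ne
  ... | same-column x≡y i≢j = trans (third-column x≡y)
          (trans (cong₂ _,_ x≡y (other-comm i≢j)) (sym (third-column (sym x≡y))))
  ... | same-level x≢y i≡j = trans (third-level x≢y i≡j)
          (trans (cong₂ _,_ (∙-comm x y) (cong next i≡j)) (sym (third-level (≢-sym x≢y) (sym i≡j))))
  ... | next-level x≢y j≡next = trans (third-next x≢y j≡next) (sym (third-prev (≢-sym x≢y)
          (λ j≡i → next-≢ i (trans (sym j≡next) j≡i))
          (λ i≡next-j → next²-≢ i (trans i≡next-j (cong next j≡next)))))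
  ... | prev-level x≢y i≢j j≢next = trans (third-prev x≢y i≢j j≢next)
          (sym (third-next (≢-sym x≢y) (predecessor i≢j j≢next)))

  third-involutive : ∀ {a b} → a ≢ b → third a (third a b) ≡ b
  third-involutive {x , i} {y , j} ne with relation ne
  ... | same-column x≡y i≢j = trans (cong (third (x , i)) (third-column x≡y))
          (trans (third-column refl) (cong₂ _,_ x≡y (other-involutive i≢j)))
  ... | same-level x≢y i≡j = trans (cong (third (x , i)) (third-level x≢y i≡j))
          (trans (third-next (∙-≢ x≢y) refl) (cong₂ _,_ (\\-∙ x y) i≡j))
  ... | next-level x≢y j≡next = trans (cong (third (x , i)) (third-next x≢y j≡next))
          (trans (third-level (≢-sym (\\-≢ x≢y)) refl) (cong₂ _,_ (∙-\\ x y) (sym j≡next)))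
  ... | prev-level x≢y i≢j j≢next = trans (cong (third (x , i)) (third-prev x≢y i≢j j≢next))
          (trans (third-prev x≢w i≢j j≢next) (cong₂ _,_ w\\x≡y refl))
    where
    w = y \\ x
    x≢w : x ≢ w
    x≢w e = x≢y (sym (∙-cancelˡ x (trans (∙-comm x y) (trans (cong (y ∙_) e) (trans (∙-\\ y x) (sym (∙-idem x)))))))
    w\\x≡y : w \\ x ≡ y
    w\\x≡y = trans (cong (w \\_) (trans (sym (∙-\\ y x)) (∙-comm y w))) (\\-∙ w y)

  steiner : SteinerTripleSystem P
  steiner = record { third = third ; third-≢ˡ = third-≢ˡ ; third-≢ʳ = third-≢ʳ
                   ; third-comm = third-comm ; third-involutive = third-involutive }

-- A half-idempotent commutative quasigroup (Skolem): the squares x ∙ x are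
-- exactly the idempotents, and every square is also the square of exactly
-- one non-idempotent, its partner.
record HalfIdempotentQuasigroup (Q : Set) : Set where
  field
    quasigroup : CommutativeQuasigroup Q
  open CommutativeQuasigroup quasigroup public
  field
    partner                 : Q → Q
    square-idempotent       : ∀ x → (x ∙ x) ∙ (x ∙ x) ≡ x ∙ x
    partner-square          : ∀ x → partner x ∙ partner x ≡ x ∙ x
    partner-of-square       : ∀ x → partner (x ∙ x) ≡ partner x
    partner-not-idempotent  : ∀ x → partner x ∙ partner x ≢ partner x
    non-idempotent-partner  : ∀ x → x ∙ x ≢ x → partner x ≡ x

-- Skolem's construction: a half-idempotent quasigroup Q yields a Steiner
-- triple system on {∞} ∪ Q × Fin 3 (∞ = nothing) with the triples
--   {(x,i), (y,i), (x ∙ y, i+1)} for x ≢ y,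
--   {(x,0), (x,1), (x,2)} and {∞, (x,i), (partner x, i+2)} for idempotent x.
module Skolem {Q : Set} (_≟_ : DecidableEquality Q) (H : HalfIdempotentQuasigroup Q) where
  open import Data.Maybe using (Maybe; just; nothing)
  open import Relation.Binary.PropositionalEquality using (refl; sym; trans; cong)
  open import Data.Fin.Properties using () renaming (_≟_ to _≟₃_)
  open ThreeElements
  open HalfIdempotentQuasigroup H

  P : Set
  P = Maybe (Q × Fin 3)

  square : Q → Q
  square x = x ∙ x

  third-∞ : Q → Fin 3 → P
  third-∞ x i with square x ≟ x
  ... | yes _ = just (partner x , next (next i))
  ... | no _ = just (square x , next i)

  third-up : Q → Fin 3 → Q → P
  third-up x i z with z ≟ square x | square x ≟ x
  ... | yes _ | yes _ = just (x , next (next i))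
  ... | yes _ | no _ = nothing
  ... | no _ | _ = just (x \\ z , i)

  third : P → P → P
  third nothing nothing = nothing
  third nothing (just (x , i)) = third-∞ x i
  third (just (x , i)) nothing = third-∞ x i
  third (just (x , i)) (just (y , j)) with i ≟₃ j
  ... | yes _ = just (x ∙ y , next i)
  ... | no _ with j ≟₃ next i
  ...   | yes _ = third-up x i y
  ...   | no _ = third-up y j x

  third-∞-idem : ∀ {x i} → square x ≡ x → third-∞ x i ≡ just (partner x , next (next i))
  third-∞-idem {x} idem with square x ≟ x
  ... | yes _ = refl
  ... | no non-idem = ⊥-elim (non-idem idem)

  third-∞-non-idem : ∀ {x i} → square x ≢ x → third-∞ x i ≡ just (square x , next i)
  third-∞-non-idem {x} non-idem with square x ≟ x
  ... | yes idem = ⊥-elim (non-idem idem)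
  ... | no _ = refl

  third-up-idem : ∀ {x i z} → z ≡ square x → square x ≡ x → third-up x i z ≡ just (x , next (next i))
  third-up-idem {x} {i} {z} z≡ idem with z ≟ square x | square x ≟ x
  ... | no z≢ | _ = ⊥-elim (z≢ z≡)
  ... | yes _ | yes _ = refl
  ... | yes _ | no non-idem = ⊥-elim (non-idem idem)

  third-up-non-idem : ∀ {x i z} → z ≡ square x → square x ≢ x → third-up x i z ≡ nothing
  third-up-non-idem {x} {i} {z} z≡ non-idem with z ≟ square x | square x ≟ x
  ... | no z≢ | _ = ⊥-elim (z≢ z≡)
  ... | yes _ | yes idem = ⊥-elim (non-idem idem)
  ... | yes _ | no _ = refl

  third-up-other : ∀ {x i z} → z ≢ square x → third-up x i z ≡ just (x \\ z , i)
  third-up-other {x} {i} {z} z≢ with z ≟ square x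
  ... | yes z≡ = ⊥-elim (z≢ z≡)
  ... | no _ = refl

  third-level : ∀ {x y i j} → i ≡ j → third (just (x , i)) (just (y , j)) ≡ just (x ∙ y , next i)
  third-level {i = i} {j} i≡j with i ≟₃ j
  ... | yes _ = refl
  ... | no i≢j = ⊥-elim (i≢j i≡j)

  third-next : ∀ {x y i j} → j ≡ next i → third (just (x , i)) (just (y , j)) ≡ third-up x i y
  third-next {i = i} {j} j≡next with i ≟₃ j
  ... | yes i≡j = ⊥-elim (next-≢ i (trans (sym j≡next) (sym i≡j)))
  ... | no _ with j ≟₃ next i
  ...   | yes _ = refl
  ...   | no j≢next = ⊥-elim (j≢next j≡next)

  third-prev : ∀ {x y i j} → i ≡ next j → third (just (x , i)) (just (y , j)) ≡ third-up y j x
  third-prev {i = i} {j} i≡next with i ≟₃ j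
  ... | yes i≡j = ⊥-elim (next-≢ j (trans (sym i≡next) i≡j))
  ... | no _ with j ≟₃ next i
  ...   | yes j≡next = ⊥-elim (next²-≢ j (trans j≡next (cong next i≡next)))
  ...   | no _ = refl

  just-≡ : ∀ {x y : Q} {i j : Fin 3} → x ≡ y → i ≡ j → _≡_ {A = P} (just (x , i)) (just (y , j))
  just-≡ refl refl = refl

  just-≡₁ : ∀ {x y : Q} {i j : Fin 3} → _≡_ {A = P} (just (x , i)) (just (y , j)) → x ≡ y
  just-≡₁ refl = refl

  just-≡₂ : ∀ {x y : Q} {i j : Fin 3} → _≡_ {A = P} (just (x , i)) (just (y , j)) → i ≡ j
  just-≡₂ refl = refl

  \\-≢ : ∀ {x y} → y ≢ square x → x \\ y ≢ x
  \\-≢ {x} {y} y≢ e = y≢ (trans (sym (∙-\\ x y)) (cong (x ∙_) e))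

  third-comm : ∀ {a b} → a ≢ b → third a b ≡ third b a
  third-comm {nothing} {nothing} _ = refl
  third-comm {nothing} {just _} _ = refl
  third-comm {just _} {nothing} _ = refl
  third-comm {just (x , i)} {just (y , j)} _ with relative-position i j
  ... | inj₁ refl = trans (third-level {x} {y} {i} refl) (trans (just-≡ (∙-comm x y) refl) (sym (third-level {y} {x} {i} refl)))
  ... | inj₂ (inj₁ refl) = trans (third-next {x} {y} {i} refl) (sym (third-prev {y} {x} {next i} {i} refl))
  ... | inj₂ (inj₂ refl) = trans (third-prev {x} {y} {next j} {j} refl) (sym (third-next {y} {x} {j} refl))

  third-∞-≢ : ∀ x i → third-∞ x i ≢ just (x , i)
  third-∞-≢ x i with square x ≟ x
  ... | yes _ = λ e → next²-≢ i (sym (just-≡₂ e))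
  ... | no _ = λ e → next-≢ i (just-≡₂ e)

  third-∞-finite : ∀ x i → third-∞ x i ≢ nothing
  third-∞-finite x i with square x ≟ x
  ... | yes _ = λ ()
  ... | no _ = λ ()

  third-up-≢ : ∀ x i z → third-up x i z ≢ just (x , i)
  third-up-≢ x i z with z ≟ square x | square x ≟ x
  ... | yes _ | yes _ = λ e → next²-≢ i (sym (just-≡₂ e))
  ... | yes _ | no _ = λ ()
  ... | no z≢ | _ = λ e → \\-≢ z≢ (just-≡₁ e)

  third-up-≢′ : ∀ x i z → third-up x i z ≢ just (z , next i)
  third-up-≢′ x i z with z ≟ square x | square x ≟ x
  ... | yes _ | yes _ = λ e → next-≢ (next i) (just-≡₂ e)
  ... | yes _ | no _ = λ ()
  ... | no _ | _ = λ e → next-≢ i (sym (just-≡₂ e))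

  third-≢ˡ : ∀ {a b} → a ≢ b → third a b ≢ a
  third-≢ˡ {nothing} {nothing} a≢b = ⊥-elim (a≢b refl)
  third-≢ˡ {nothing} {just (x , i)} _ = third-∞-finite x i
  third-≢ˡ {just (x , i)} {nothing} _ = third-∞-≢ x i
  third-≢ˡ {just (x , i)} {just (y , j)} _ with relative-position i j
  ... | inj₁ refl = λ e → next-≢ i (just-≡₂ (trans (sym (third-level {x} {y} {i} refl)) e))
  ... | inj₂ (inj₁ refl) = λ e → third-up-≢ x i y (trans (sym (third-next {x} {y} {i} refl)) e)
  ... | inj₂ (inj₂ refl) = λ e → third-up-≢′ y j x (trans (sym (third-prev {x} {y} {next j} {j} refl)) e)

  third-≢ʳ : ∀ {a b} → a ≢ b → third a b ≢ b
  third-≢ʳ {a} {b} a≢b e = third-≢ˡ (≢-sym a≢b) (trans (sym (third-comm a≢b)) e)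

  -- involutivity, by the relative position of the two points; case splits
  -- use this decision so that third-∞ and third-up stay folded in goals
  decide : ∀ (a b : Q) → a ≡ b ⊎ a ≢ b
  decide a b with a ≟ b
  ... | yes a≡b = inj₁ a≡b
  ... | no a≢b = inj₂ a≢b

  involutive-∞ : ∀ x i → third nothing (third nothing (just (x , i))) ≡ just (x , i)
  involutive-∞ x i with decide (square x) x
  ... | inj₁ idem = trans (cong (third nothing) (third-∞-idem idem))
      (trans (third-∞-non-idem (partner-not-idempotent x))
        (just-≡ (trans (partner-square x) idem) (next³ i)))
  ... | inj₂ non-idem = trans (cong (third nothing) (third-∞-non-idem non-idem))
      (trans (third-∞-idem (square-idempotent x))
        (just-≡ (trans (partner-of-square x) (non-idempotent-partner x non-idem)) (next³ i)))

  involutive-to-∞ : ∀ x i → third (just (x , i)) (third (just (x , i)) nothing) ≡ nothing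
  involutive-to-∞ x i with decide (square x) x
  ... | inj₁ idem = trans (cong (third (just (x , i))) (third-∞-idem idem))
      (trans (third-prev {x} {partner x} {i} {next (next i)} (sym (next³ i)))
        (third-up-non-idem (sym (trans (partner-square x) idem)) (partner-not-idempotent x)))
  ... | inj₂ non-idem = trans (cong (third (just (x , i))) (third-∞-non-idem non-idem))
      (trans (third-next {x} {square x} {i} refl) (third-up-non-idem refl non-idem))

  involutive-level : ∀ {x y i} → x ≢ y → third (just (x , i)) (third (just (x , i)) (just (y , i))) ≡ just (y , i)
  involutive-level {x} {y} {i} x≢y = trans (cong (third (just (x , i))) (third-level {x} {y} {i} refl))
    (trans (third-next {x} {x ∙ y} {i} refl) (trans (third-up-other xy≢) (just-≡ (\\-∙ x y) refl)))
    where
    xy≢ : x ∙ y ≢ square x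
    xy≢ e = x≢y (sym (∙-cancelˡ x e))

  involutive-next : ∀ x i y → third (just (x , i)) (third (just (x , i)) (just (y , next i))) ≡ just (y , next i)
  involutive-next x i y with decide y (square x) | decide (square x) x
  ... | inj₂ y≢ | _ = trans (cong (third (just (x , i))) (trans (third-next {x} {y} {i} refl) (third-up-other y≢)))
      (trans (third-level {x} {x \\ y} {i} refl) (just-≡ (∙-\\ x y) refl))
  ... | inj₁ y≡ | inj₁ idem = trans (cong (third (just (x , i))) (trans (third-next {x} {y} {i} refl) (third-up-idem y≡ idem)))
      (trans (third-prev {x} {x} {i} {next (next i)} (sym (next³ i))) (trans (third-up-idem (sym idem) idem)
        (just-≡ (trans (sym idem) (sym y≡)) (next³ (next i)))))
  ... | inj₁ y≡ | inj₂ non-idem = trans (cong (third (just (x , i))) (trans (third-next {x} {y} {i} refl) (third-up-non-idem y≡ non-idem)))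
      (trans (third-∞-non-idem non-idem) (just-≡ (sym y≡) refl))

  involutive-prev : ∀ x j y → third (just (x , next j)) (third (just (x , next j)) (just (y , j))) ≡ just (y , j)
  involutive-prev x j y with decide x (square y) | decide (square y) y
  ... | inj₂ x≢ | _ = trans (cong (third (just (x , next j))) (trans (third-prev {x} {y} {next j} {j} refl) (third-up-other x≢)))
      (trans (third-prev {x} {w} {next j} {j} refl) (trans (third-up-other x≢w²) (just-≡ w\\x≡y refl)))
    where
    w = y \\ x
    w∙y≡x : w ∙ y ≡ x
    w∙y≡x = trans (∙-comm w y) (∙-\\ y x)
    x≢w² : x ≢ square w
    x≢w² e = x≢ (trans e (cong square (sym (∙-cancelˡ w (trans w∙y≡x e)))))
    w\\x≡y : w \\ x ≡ y
    w\\x≡y = trans (cong (w \\_) (sym w∙y≡x)) (\\-∙ w y)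
  ... | inj₁ x≡ | inj₁ idem = trans (cong (third (just (x , next j))) (trans (third-prev {x} {y} {next j} {j} refl) (third-up-idem x≡ idem)))
      (at-idempotent (trans x≡ idem))
    where
    at-idempotent : x ≡ y → third (just (x , next j)) (just (y , next (next j))) ≡ just (y , j)
    at-idempotent refl = trans (third-next {x} {x} {next j} {next (next j)} refl) (trans (third-up-idem (sym idem) idem) (just-≡ refl (next³ j)))
  ... | inj₁ x≡ | inj₂ non-idem = trans (cong (third (just (x , next j))) (trans (third-prev {x} {y} {next j} {j} refl) (third-up-non-idem x≡ non-idem)))
      (trans (third-∞-idem x-idem) (just-≡ partner≡y (next³ j)))
    where
    x-idem : square x ≡ x
    x-idem = trans (cong square x≡) (trans (square-idempotent y) (sym x≡))
    partner≡y : partner x ≡ y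
    partner≡y = trans (cong partner x≡) (trans (partner-of-square y) (non-idempotent-partner y non-idem))

  third-involutive : ∀ {a b} → a ≢ b → third a (third a b) ≡ b
  third-involutive {nothing} {nothing} a≢b = ⊥-elim (a≢b refl)
  third-involutive {nothing} {just (x , i)} _ = involutive-∞ x i
  third-involutive {just (x , i)} {nothing} _ = involutive-to-∞ x i
  third-involutive {just (x , i)} {just (y , j)} a≢b with relative-position i j
  ... | inj₁ refl = involutive-level (λ { refl → a≢b refl })
  ... | inj₂ (inj₁ refl) = involutive-next x i y
  ... | inj₂ (inj₂ refl) = involutive-prev x j y

  steiner : SteinerTripleSystem P
  steiner = record { third = third ; third-≢ˡ = third-≢ˡ ; third-≢ʳ = third-≢ʳ
                   ; third-comm = third-comm ; third-involutive = third-involutive }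

module ModularArithmetic (L : ℕ) .{{_ : NonZero L}} where
  open import Data.Nat using (_+_; _*_; _∸_; _≤_)
  open import Data.Nat.DivMod using (m%n%n≡m%n; [m+kn]%n≡m%n; %-distribˡ-+; %-distribˡ-*)
  open import Relation.Binary.PropositionalEquality using (sym; trans; cong; module ≡-Reasoning)
  open ≡-Reasoning

  +-congʳ-mod : ∀ a b c → a % L ≡ b % L → (a + c) % L ≡ (b + c) % L
  +-congʳ-mod a b c e = trans (%-distribˡ-+ a c L)
    (trans (cong (λ u → (u + c % L) % L) e) (sym (%-distribˡ-+ b c L)))

  +-congˡ-mod : ∀ a b c → a % L ≡ b % L → (c + a) % L ≡ (c + b) % L
  +-congˡ-mod a b c e = trans (%-distribˡ-+ c a L)
    (trans (cong (λ u → (c % L + u) % L) e) (sym (%-distribˡ-+ c b L)))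

  *-congʳ-mod : ∀ a b c → a % L ≡ b % L → (a * c) % L ≡ (b * c) % L
  *-congʳ-mod a b c e = trans (%-distribˡ-* a c L)
    (trans (cong (λ u → (u * (c % L)) % L) e) (sym (%-distribˡ-* b c L)))

  *-congˡ-mod : ∀ a b c → a % L ≡ b % L → (c * a) % L ≡ (c * b) % L
  *-congˡ-mod a b c e = trans (%-distribˡ-* c a L)
    (trans (cong (λ u → ((c % L) * u) % L) e) (sym (%-distribˡ-* c b L)))

  +-L : ∀ a → (a + L) % L ≡ a % L
  +-L a = trans (cong (λ u → (a + u) % L) (sym (ℕP.*-identityˡ L))) ([m+kn]%n≡m%n a 1 L)

  add-sub : ∀ X S → X ≤ L → (X + (S + (L ∸ X)) % L) % L ≡ S % L
  add-sub X S X≤L = begin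
    (X + (S + (L ∸ X)) % L) % L ≡⟨ +-congˡ-mod _ (S + (L ∸ X)) X (m%n%n≡m%n (S + (L ∸ X)) L) ⟩
    (X + (S + (L ∸ X))) % L      ≡⟨ cong (_% L) rearrange ⟩
    (S + L) % L                  ≡⟨ +-L S ⟩
    S % L ∎
    where
    rearrange : X + (S + (L ∸ X)) ≡ S + L
    rearrange = trans (sym (ℕP.+-assoc X S (L ∸ X))) (trans (cong (_+ (L ∸ X)) (ℕP.+-comm X S))
      (trans (ℕP.+-assoc S X (L ∸ X)) (cong (S +_) (ℕP.m+[n∸m]≡n X≤L))))

  sub-add : ∀ X W → X ≤ L → ((X + W) % L + (L ∸ X)) % L ≡ W % L
  sub-add X W X≤L = begin
    ((X + W) % L + (L ∸ X)) % L ≡⟨ +-congʳ-mod _ (X + W) (L ∸ X) (m%n%n≡m%n (X + W) L) ⟩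
    (X + W + (L ∸ X)) % L       ≡⟨ cong (_% L) rearrange ⟩
    (W + L) % L                 ≡⟨ +-L W ⟩
    W % L ∎
    where
    rearrange : X + W + (L ∸ X) ≡ W + L
    rearrange = trans (cong (_+ (L ∸ X)) (ℕP.+-comm X W))
      (trans (ℕP.+-assoc W X (L ∸ X)) (cong (W +_) (ℕP.m+[n∸m]≡n X≤L)))

-- Bose's quasigroup on Fin (2k+1): x ∙ y = (x + y)(k + 1), the "average" of
-- x and y modulo 2k+1, with x \\ z = 2z − x.  It is idempotent.
module BoseQuasigroup (k : ℕ) where
  open import Data.Nat using (_+_; _*_; _∸_; _<_; _≤_)
  open import Data.Nat.DivMod using (m%n%n≡m%n; [m+kn]%n≡m%n; m%n<n; m<n⇒m%n≡m)
  open import Data.Nat.Tactic.RingSolver using (solve-∀)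
  open import Data.Fin using (fromℕ<)
  open import Relation.Binary.PropositionalEquality using (sym; trans; cong; module ≡-Reasoning)
  open ≡-Reasoning

  v : ℕ
  v = suc (2 * k)
  open ModularArithmetic v

  average sub : ℕ → ℕ → ℕ
  average x y = ((x + y) * suc k) % v
  sub x z = (2 * z + (v ∸ x)) % v

  average-sub : ∀ X Z → X ≤ v → Z < v → average X (sub X Z) ≡ Z
  average-sub X Z X≤v Z<v = begin
    ((X + sub X Z) * suc k) % v ≡⟨ *-congʳ-mod (X + sub X Z) (2 * Z) (suc k) (add-sub X (2 * Z) X≤v) ⟩
    ((2 * Z) * suc k) % v       ≡⟨ cong (_% v) (twice-half Z k) ⟩
    (Z + Z * v) % v             ≡⟨ [m+kn]%n≡m%n Z Z v ⟩
    Z % v                       ≡⟨ m<n⇒m%n≡m Z<v ⟩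
    Z ∎
    where
    twice-half : ∀ z k → 2 * z * suc k ≡ z + z * suc (2 * k)
    twice-half = solve-∀

  sub-average : ∀ X W → X ≤ v → W < v → sub X (average X W) ≡ W
  sub-average X W X≤v W<v = begin
    (2 * A + d) % v                 ≡⟨ +-congʳ-mod (2 * A) (2 * ((X + W) * suc k)) d
                                         (*-congˡ-mod A ((X + W) * suc k) 2 (m%n%n≡m%n ((X + W) * suc k) v)) ⟩
    (2 * ((X + W) * suc k) + d) % v ≡⟨ cong (_% v) (expand X W d k) ⟩
    (W + (X + W) * v + (X + d)) % v ≡⟨ cong (λ u → (W + (X + W) * v + u) % v) (ℕP.m+[n∸m]≡n X≤v) ⟩
    (W + (X + W) * v + v) % v       ≡⟨ cong (_% v) (collect W (X + W) v) ⟩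
    (W + suc (X + W) * v) % v       ≡⟨ [m+kn]%n≡m%n W (suc (X + W)) v ⟩
    W % v                           ≡⟨ m<n⇒m%n≡m W<v ⟩
    W ∎
    where
    A = average X W
    d = v ∸ X
    expand : ∀ x w d k → 2 * ((x + w) * suc k) + d ≡ w + (x + w) * suc (2 * k) + (x + d)
    expand = solve-∀
    collect : ∀ w y u → w + y * u + u ≡ w + suc y * u
    collect = solve-∀

  -- (x + x)(k + 1) = x (2k + 1) + x ≡ x
  average-idem : ∀ X → X < v → average X X ≡ X
  average-idem X X<v = trans (cong (_% v) (double X k)) (trans ([m+kn]%n≡m%n X X v) (m<n⇒m%n≡m X<v))
    where
    double : ∀ x k → (x + x) * suc k ≡ x + x * suc (2 * k)
    double = solve-∀

  _∙_ _\\_ : Fin v → Fin v → Fin v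
  x ∙ y = fromℕ< (m%n<n ((toℕ x + toℕ y) * suc k) v)
  x \\ z = fromℕ< (m%n<n (2 * toℕ z + (v ∸ toℕ x)) v)

  toℕ-∙ : ∀ x y → toℕ (x ∙ y) ≡ average (toℕ x) (toℕ y)
  toℕ-∙ x y = FinP.toℕ-fromℕ< _

  toℕ-\\ : ∀ x z → toℕ (x \\ z) ≡ sub (toℕ x) (toℕ z)
  toℕ-\\ x z = FinP.toℕ-fromℕ< _

  quasigroup : CommutativeQuasigroup (Fin v)
  quasigroup = record
    { _∙_ = _∙_ ; _\\_ = _\\_
    ; ∙-comm = λ x y → FinP.toℕ-injective (trans (toℕ-∙ x y)
        (trans (cong (λ u → (u * suc k) % v) (ℕP.+-comm (toℕ x) (toℕ y))) (sym (toℕ-∙ y x))))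
    ; ∙-\\ = λ x z → FinP.toℕ-injective (trans (toℕ-∙ x (x \\ z))
        (trans (cong (average (toℕ x)) (toℕ-\\ x z))
          (average-sub (toℕ x) (toℕ z) (ℕP.<⇒≤ (FinP.toℕ<n x)) (FinP.toℕ<n z))))
    ; \\-∙ = λ x w → FinP.toℕ-injective (trans (toℕ-\\ x (x ∙ w))
        (trans (cong (sub (toℕ x)) (toℕ-∙ x w))
          (sub-average (toℕ x) (toℕ w) (ℕP.<⇒≤ (FinP.toℕ<n x)) (FinP.toℕ<n w))))
    }

  idempotent : ∀ x → x ∙ x ≡ x
  idempotent x = FinP.toℕ-injective (trans (toℕ-∙ x x) (average-idem (toℕ x) (FinP.toℕ<n x)))

-- Skolem's half-idempotent quasigroup on Fin (2K): writing s = (x + y) mod 2K,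
-- x ∙ y = ⌊s/2⌋ + K·(s mod 2), and x \\ z inverts this.  Every x = q + K·r
-- (q < K) has square q; the idempotents are the q < K, and the partner of
-- x is K + q.
module SkolemQuasigroup (k : ℕ) where
  open import Data.Nat using (_+_; _*_; _∸_; _<_; _≤_)
  open import Data.Nat.DivMod using ([m+kn]%n≡m%n; m%n<n; m<n⇒m%n≡m)
  open import Data.Nat.Tactic.RingSolver using (solve-∀)
  open import Data.Fin using (fromℕ<; combine; remQuot)
  open import Relation.Binary.PropositionalEquality using (sym; trans; cong; subst)

  K L : ℕ
  K = suc k
  L = 2 * K
  open ModularArithmetic L

  -- Fin (K * 2) → Fin (2 * K):  2q + r ↦ q + K r
  halve : Fin (K * 2) → Fin L
  halve j = combine (proj₂ (remQuot {K} 2 j)) (proj₁ (remQuot {K} 2 j))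

  unhalve : Fin L → Fin (K * 2)
  unhalve z = combine (proj₂ (remQuot {2} K z)) (proj₁ (remQuot {2} K z))

  halve-unhalve : ∀ z → halve (unhalve z) ≡ z
  halve-unhalve z = trans (cong (λ p → combine (proj₂ p) (proj₁ p))
    (FinP.remQuot-combine {K} {2} (proj₂ (remQuot {2} K z)) (proj₁ (remQuot {2} K z))))
    (FinP.combine-remQuot {2} K z)

  unhalve-halve : ∀ j → unhalve (halve j) ≡ j
  unhalve-halve j = trans (cong (λ p → combine (proj₂ p) (proj₁ p))
    (FinP.remQuot-combine {2} {K} (proj₂ (remQuot {K} 2 j)) (proj₁ (remQuot {K} 2 j))))
    (FinP.combine-remQuot {K} 2 j)

  sum : Fin L → Fin L → Fin (K * 2)
  sum x y = fromℕ< (subst ((toℕ x + toℕ y) % L <_) (ℕP.*-comm 2 K) (m%n<n (toℕ x + toℕ y) L))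

  toℕ-sum : ∀ x y → toℕ (sum x y) ≡ (toℕ x + toℕ y) % L
  toℕ-sum x y = FinP.toℕ-fromℕ< _

  _∙_ _\\_ : Fin L → Fin L → Fin L
  x ∙ y = halve (sum x y)
  x \\ z = fromℕ< (m%n<n (toℕ (unhalve z) + (L ∸ toℕ x)) L)

  toℕ-\\ : ∀ x z → toℕ (x \\ z) ≡ (toℕ (unhalve z) + (L ∸ toℕ x)) % L
  toℕ-\\ x z = FinP.toℕ-fromℕ< _

  <L : ∀ {a} → a < K * 2 → a < L
  <L {a} = subst (a <_) (ℕP.*-comm K 2)

  ≤L : ∀ (x : Fin L) → toℕ x ≤ L
  ≤L x = ℕP.<⇒≤ (FinP.toℕ<n x)

  ∙-\\ : ∀ x z → x ∙ (x \\ z) ≡ z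
  ∙-\\ x z = trans (cong halve sum≡) (halve-unhalve z)
    where
    sum≡ : sum x (x \\ z) ≡ unhalve z
    sum≡ = FinP.toℕ-injective (trans (toℕ-sum x (x \\ z))
      (trans (cong (λ u → (toℕ x + u) % L) (toℕ-\\ x z))
        (trans (add-sub (toℕ x) (toℕ (unhalve z)) (≤L x)) (m<n⇒m%n≡m (<L (FinP.toℕ<n (unhalve z)))))))

  \\-∙ : ∀ x w → x \\ (x ∙ w) ≡ w
  \\-∙ x w = FinP.toℕ-injective (trans (toℕ-\\ x (x ∙ w))
    (trans (cong (λ u → (toℕ u + (L ∸ toℕ x)) % L) (unhalve-halve (sum x w)))
      (trans (cong (λ u → (u + (L ∸ toℕ x)) % L) (toℕ-sum x w))
        (trans (sub-add (toℕ x) (toℕ w) (≤L x)) (m<n⇒m%n≡m (FinP.toℕ<n w))))))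

  ∙-comm : ∀ x y → x ∙ y ≡ y ∙ x
  ∙-comm x y = cong halve (FinP.toℕ-injective (trans (toℕ-sum x y)
    (trans (cong (_% L) (ℕP.+-comm (toℕ x) (toℕ y))) (sym (toℕ-sum y x)))))

  quasigroup : CommutativeQuasigroup (Fin L)
  quasigroup = record { _∙_ = _∙_ ; _\\_ = _\\_ ; ∙-comm = ∙-comm ; ∙-\\ = ∙-\\ ; \\-∙ = \\-∙ }

  -- x = column x + K · row x
  column : Fin L → Fin K
  column x = proj₂ (remQuot {2} K x)

  row : Fin L → Fin 2
  row x = proj₁ (remQuot {2} K x)

  at : Fin 2 → Fin K → Fin L
  at = combine {2} {K}

  column-at : ∀ r q → column (at r q) ≡ q
  column-at r q = cong proj₂ (FinP.remQuot-combine {2} {K} r q)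

  toℕ-decomposition : ∀ x → toℕ x ≡ K * toℕ (row x) + toℕ (column x)
  toℕ-decomposition x = trans (cong toℕ (sym (FinP.combine-remQuot {2} K x))) (FinP.toℕ-combine (row x) (column x))

  sum-self : ∀ x → sum x x ≡ combine {K} {2} (column x) 0F
  sum-self x = FinP.toℕ-injective (trans (toℕ-sum x x)
    (trans (cong (λ u → (u + u) % L) (toℕ-decomposition x))
      (trans (cong (_% L) (double (toℕ (row x)) (toℕ (column x)) K))
        (trans ([m+kn]%n≡m%n (2 * toℕ (column x) + 0) (toℕ (row x)) L)
          (trans (m<n⇒m%n≡m 2q<L) (sym (FinP.toℕ-combine (column x) 0F)))))))
    where
    double : ∀ r q k → (k * r + q) + (k * r + q) ≡ (2 * q + 0) + r * (2 * k)
    double = solve-∀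
    2q<L : 2 * toℕ (column x) + 0 < L
    2q<L = subst (_< L) (sym (ℕP.+-identityʳ _)) (ℕP.*-monoʳ-< 2 (FinP.toℕ<n (column x)))

  square : ∀ x → x ∙ x ≡ at 0F (column x)
  square x = trans (cong halve (sum-self x))
    (cong (λ p → combine (proj₂ p) (proj₁ p)) (FinP.remQuot-combine {K} {2} (column x) 0F))

  partner : Fin L → Fin L
  partner x = at 1F (column x)

  square-idempotent : ∀ x → (x ∙ x) ∙ (x ∙ x) ≡ x ∙ x
  square-idempotent x = trans (square (x ∙ x))
    (trans (cong (λ u → at 0F (column u)) (square x)) (trans (cong (at 0F) (column-at 0F (column x))) (sym (square x))))

  partner-square : ∀ x → partner x ∙ partner x ≡ x ∙ x
  partner-square x = trans (square (partner x)) (trans (cong (at 0F) (column-at 1F (column x))) (sym (square x)))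

  partner-of-square : ∀ x → partner (x ∙ x) ≡ partner x
  partner-of-square x = trans (cong partner (square x)) (cong (at 1F) (column-at 0F (column x)))

  partner-not-idempotent : ∀ x → partner x ∙ partner x ≢ partner x
  partner-not-idempotent x e = 0≢1 (FinP.combine-injectiveˡ {2} {K} 0F (column x) 1F (column x) bottom≡top)
    where
    0≢1 : _≢_ {A = Fin 2} 0F 1F
    0≢1 ()
    bottom≡top : at 0F (column x) ≡ at 1F (column x)
    bottom≡top = trans (sym (trans (square (partner x)) (cong (at 0F) (column-at 1F (column x))))) e

  non-idempotent-partner : ∀ x → x ∙ x ≢ x → partner x ≡ x
  non-idempotent-partner x non-idem with row x | FinP.combine-remQuot {2} K x
  ... | 0F | x≡ = ⊥-elim (non-idem (trans (square x) x≡))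
  ... | 1F | x≡ = x≡

  halfIdempotent : HalfIdempotentQuasigroup (Fin L)
  halfIdempotent = record
    { quasigroup = quasigroup ; partner = partner
    ; square-idempotent = square-idempotent ; partner-square = partner-square
    ; partner-of-square = partner-of-square ; partner-not-idempotent = partner-not-idempotent
    ; non-idempotent-partner = non-idempotent-partner }

-- Steiner triple systems on Fin n exist for n ≡ 1, 3 (mod 6): n = 3(2k+1)
-- by Bose, n = 1 + 3·2(k+1) by Skolem, and the trivial system for n = 1.
module Existence where
  open import Data.Nat using (_+_; _*_)
  open import Data.Nat.DivMod using (m≡m%n+[m/n]*n)
  open import Data.Nat.Tactic.RingSolver using (solve-∀)
  open import Data.Maybe using (Maybe; just; nothing)
  open import Function using (_∘_)
  open import Function.Bundles using (Inverse; mk↔ₛ′)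
  open import Relation.Binary.PropositionalEquality using (refl; sym; trans; cong; subst)

  suc↔Maybe : ∀ {N} {A : Set} → Fin N ↔ A → Fin (suc N) ↔ Maybe A
  suc↔Maybe {N} {A} N↔A = mk↔ₛ′ to′ from′ to-from from-to
    where
    open Inverse N↔A
    to′ : Fin (suc N) → Maybe A
    to′ zero = nothing
    to′ (suc i) = just (to i)
    from′ : Maybe A → Fin (suc N)
    from′ nothing = zero
    from′ (just a) = suc (from a)
    to-from : ∀ a → to′ (from′ a) ≡ a
    to-from nothing = refl
    to-from (just a) = cong just (strictlyInverseˡ a)
    from-to : ∀ i → from′ (to′ i) ≡ i
    from-to zero = refl
    from-to (suc i) = cong suc (strictlyInverseʳ i)

  bose : ∀ k → SteinerTripleSystem (Fin (suc (2 * k) * 3))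
  bose k = transport FinP.*↔×
    (Bose.steiner FinP._≟_ (BoseQuasigroup.quasigroup k) (BoseQuasigroup.idempotent k))

  skolem : ∀ k → SteinerTripleSystem (Fin (suc (2 * suc k * 3)))
  skolem k = transport (suc↔Maybe FinP.*↔×)
    (Skolem.steiner FinP._≟_ (SkolemQuasigroup.halfIdempotent k))

  one-point : SteinerTripleSystem (Fin 1)
  one-point = record
    { third = λ a _ → a
    ; third-≢ˡ = λ a≢b → ⊥-elim (a≢b (single _ _))
    ; third-≢ʳ = λ a≢b → ⊥-elim (a≢b (single _ _))
    ; third-comm = λ a≢b → ⊥-elim (a≢b (single _ _))
    ; third-involutive = λ a≢b → ⊥-elim (a≢b (single _ _))
    }
    where
    single : ∀ (a b : Fin 1) → a ≡ b
    single zero zero = refl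

  steiner-exists : ∀ n → n % 6 ≡ 1 ⊎ n % 6 ≡ 3 → SteinerTripleSystem (Fin n)
  steiner-exists n (inj₂ n%6≡3) = subst (SteinerTripleSystem ∘ Fin) (sym n≡) (bose (n / 6))
    where
    bose-size : ∀ q → 3 + q * 6 ≡ suc (2 * q) * 3
    bose-size = solve-∀
    n≡ : n ≡ suc (2 * (n / 6)) * 3
    n≡ = trans (m≡m%n+[m/n]*n n 6) (trans (cong (_+ (n / 6) * 6) n%6≡3) (bose-size (n / 6)))
  steiner-exists n (inj₁ n%6≡1) with n / 6 | m≡m%n+[m/n]*n n 6
  ... | zero | n≡ = subst (SteinerTripleSystem ∘ Fin) (sym (trans n≡ (cong (_+ 0) n%6≡1))) one-point
  ... | suc k | n≡ = subst (SteinerTripleSystem ∘ Fin)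
        (sym (trans n≡ (trans (cong (_+ suc k * 6) n%6≡1) (skolem-size k)))) (skolem k)
    where
    skolem-size : ∀ k → 1 + suc k * 6 ≡ suc (2 * suc k * 3)
    skolem-size = solve-∀

lemma7p3 : ∀ {c ℓ : Level} (F : OrderedField c ℓ) (n : ℕ) →
           (n % 6 ≡ 1 ⊎ n % 6 ≡ 3) →
           (V : Fin n → Plane.Point F) →
           Plane.Distinct F V →
           Plane.GeneralPosition F V →
           Plane._≤α[_] F ((n C 2) / 3) V
lemma7p3 F n n≡1,3 V _ general =
  DisjointnessColouring.triangle-colouring F V general (Existence.steiner-exists n n≡1,3)
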